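{- Let \(H=(V,E)\) be a simple, undirected, connected graph that is not a cactus, with \(|V|\ge 5\). Then there exists a spanning cactus subgraph of \(H\) with the maximum number of edges among all spanning cactus subgraphs of \(H\) that has a cut vertex.
   Context: A cactus is a connected graph in which every edge belongs to at most one (simple) cycle. A spanning cactus subgraph of \(H\) is a subgraph with vertex set \(V\) that is a cactus. -}

module Defs where

open import Data.Nat using (ℕ; _≤_; _<ᵇ_)
open import Data.Fin using (Fin; toℕ)
open import Data.Bool using (Bool; true; false; if_then_else_; _∧_)
open import Data.List using (List; []; _∷_; _++_; take; length; map; allFin)
open import Data.Nat.ListAction using (sum)
open import Data.List.Relation.Unary.Unique.Propositional using (Unique)
open import Data.Product using (Σ; _×_; ∃-syntax)
open import Data.Unit using (⊤)
open import Data.Sum using (_⊎_)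
open import Relation.Binary.PropositionalEquality using (_≡_; _≢_)
open import Relation.Nullary using (¬_)

record Graph (n : ℕ) : Set where
  field
    adj    : Fin n → Fin n → Bool
    sym    : ∀ i j → adj i j ≡ adj j i
    irrefl : ∀ i → adj i i ≡ false
open Graph public

module _ {n : ℕ} where

  -- S is a subgraph of H on the same vertex set (i.e. a spanning subgraph).
  _⊆G_ : Graph n → Graph n → Set
  S ⊆G H = ∀ i j → adj S i j ≡ true → adj H i j ≡ true

  edgeCount : Graph n → ℕ
  edgeCount G = sum (map (λ i → sum (map (λ j →
    if (toℕ i <ᵇ toℕ j) ∧ adj G i j then 1 else 0) (allFin n))) (allFin n))

  -- Walks inside the set of vertices satisfying P (every vertex after the start).
  data Reach (G : Graph n) (P : Fin n → Set) : Fin n → Fin n → Set where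
    here : ∀ {u} → Reach G P u u
    step : ∀ {u w v} → adj G u w ≡ true → P w → Reach G P w v → Reach G P u v

  Connected : Graph n → Set
  Connected G = ∀ u v → Reach G (λ _ → ⊤) u v

  data Step (x y : Fin n) : List (Fin n) → Set where
    here  : ∀ {l} → Step x y (x ∷ y ∷ l)
    there : ∀ {a l} → Step x y l → Step x y (a ∷ l)

  record Cycle (G : Graph n) : Set where
    field
      verts  : List (Fin n)
      len    : 3 ≤ length verts
      uniq   : Unique verts
      closed : ∀ x y → Step x y (verts ++ take 1 verts) → adj G x y ≡ true
  open Cycle public

  CycEdge : {G : Graph n} → Cycle G → Fin n → Fin n → Set
  CycEdge c x y = Step x y (verts c ++ take 1 (verts c))
                ⊎ Step y x (verts c ++ take 1 (verts c))

  -- Two cycles are the same (as subgraphs) iff they have the same edge set.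
  SameCycle : {G : Graph n} → Cycle G → Cycle G → Set
  SameCycle c₁ c₂ = ∀ a b → (CycEdge c₁ a b → CycEdge c₂ a b) × (CycEdge c₂ a b → CycEdge c₁ a b)

  Cactus : Graph n → Set
  Cactus G = Connected G ×
    (∀ (c₁ c₂ : Cycle G) x y → CycEdge c₁ x y → CycEdge c₂ x y → SameCycle c₁ c₂)

  CutVertex : Graph n → Fin n → Set
  CutVertex G v = ∃[ u ] ∃[ w ] (u ≢ v × w ≢ v × ¬ Reach G (λ x → x ≢ v) u w)

{-# OPTIONS --safe #-}
module Submission where

-- Spanning cacti exist (a connected spanning subgraph with fewest edges has no cycle), so there is
-- one, S, with the most edges. If S has no cut vertex, it is a Hamiltonian cycle carrying all of its
-- edges: the end of a longest path closes a cycle, and a vertex or an edge off a cycle would give an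
-- ear, which together with an arc of the cycle forms a second cycle sharing an edge with the first.
-- As H is not a cactus, it has an edge ab outside S. Deleting the cycle edge za entering a and adding
-- ab keeps the number of edges and leaves the cycle a … b with the path b … z hanging at b: a cactus
-- in which b is a cut vertex. Its cycles are pinned down by cuts, which every cycle crosses an even
-- number of times.

open import Defs hiding (sym)
open import Data.Bool using (Bool; true; false; _∧_; _∨_; not; if_then_else_)
open import Data.Bool.Properties using (∧-comm; ∧-zeroʳ; ∧-idem; ∧-identityʳ; ∨-identityʳ; ∨-zeroʳ)
import Data.Bool.Properties as Bool
open import Data.Fin using (Fin; toℕ; fromℕ<) renaming (zero to fzero; suc to fsuc)
open import Data.Fin.Properties using (_≟_; any?; all?; pigeonhole; toℕ-injective)
open import Data.List using (List; []; _∷_; _++_; [_]; take; length; map; allFin; filter; cartesianProductWith)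
import Data.List as List
open import Data.List.Extrema.Nat using (argmax; argmin; argmax-all; argmin-all; f[xs]≤f[argmax]; f[argmin]≤f[xs])
open import Data.List.Membership.Propositional using (_∈_; _∉_; lose)
open import Data.List.Membership.Propositional.Properties
  using (∈-++⁺ˡ; ∈-++⁻; ∈-∃++; ∈-allFin; ∈-filter⁺; ∈-filter⁻; ∈-cartesianProductWith⁺; ∈-map⁺; ∈-lookup)
open import Data.List.Properties using (++-assoc; ++-identityʳ; length-++; map-cong)
open import Data.List.Relation.Binary.Disjoint.Propositional using (Disjoint)
open import Data.List.Relation.Binary.Permutation.Propositional.Properties using (∈-resp-↭; ++-comm)
open import Data.List.Relation.Unary.All using (All; []; _∷_)
import Data.List.Relation.Unary.All as All
open import Data.List.Relation.Unary.All.Properties using (¬Any⇒All¬; All¬⇒¬Any; all-filter)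
import Data.List.Relation.Unary.All.Properties as Allₚ
open import Data.List.Relation.Unary.Any using (Any; here; there)
open import Data.List.Relation.Unary.Unique.Propositional using (Unique; []; _∷_)
open import Data.List.Relation.Unary.Unique.Propositional.Properties using (Unique[x∷xs]⇒x∉xs; ++⁺; allFin⁺)
open import Data.Maybe using (Maybe; just; nothing)
open import Data.Maybe.Properties using (just-injective)
open import Data.Nat using (ℕ; zero; suc; _+_; _≤_; _<_; z≤n; s≤s; _≤?_; _<ᵇ_)
open import Data.Nat.ListAction using (sum)
open import Data.Nat.Properties
  using (≤-refl; ≤-trans; ≤-antisym; <-irrefl; <-trans; <-asym; <-cmp; n<1+n; n≤1+n; ≤-pred; suc-injective;
         +-comm; +-suc; m≤n+m; ≮⇒≥; ≰⇒>; ≤∧≢⇒<; ≤-reflexive; n≮0; _<?_)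
open import Data.Product using (_×_; _,_; proj₁; proj₂; ∃₂; ∃-syntax) renaming (swap to ×-swap)
open import Data.Sum using (_⊎_; inj₁; inj₂) renaming (swap to ⊎-swap)
open import Data.Unit using (⊤; tt)
open import Data.Vec using (Vec; lookup; tabulate) renaming ([] to []ᵥ; _∷_ to _∷ᵥ_)
open import Data.Vec.Properties using (lookup∘tabulate)
open import Function using (_∘_)
open import Function.Bundles using (mk⇔)
open import Relation.Binary.Definitions using (tri<; tri≈; tri>)
open import Relation.Binary.PropositionalEquality using (_≡_; _≢_; refl; sym; trans; cong; cong₂; subst)
open import Relation.Nullary using (¬_; Dec; yes; no; does; contradiction)
open import Relation.Nullary.Decidable using (map′; _×-dec_; _⊎-dec_; _→-dec_; ¬?; dec-true; dec-false; does-⇔; decidable-stable)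
open import Relation.Unary using (Decidable)

module _ {n : ℕ} where
  open import Data.List.Membership.DecPropositional (_≟_ {n}) public using (_∈?_)
  open import Data.List.Relation.Unary.Unique.DecPropositional (_≟_ {n}) public using (unique?)

module _ {A : Set} where

  ∈∉⇒≢ : ∀ {x y : A} {l} → x ∈ l → y ∉ l → y ≢ x
  ∈∉⇒≢ x∈l y∉l refl = y∉l x∈l

  Unique-∷ : ∀ {x : A} {xs} → x ∉ xs → Unique xs → Unique (x ∷ xs)
  Unique-∷ {xs = xs} x∉xs uniq = ¬Any⇒All¬ xs x∉xs ∷ uniq

  Unique-++⁻ˡ : ∀ xs {ys : List A} → Unique (xs ++ ys) → Unique xs
  Unique-++⁻ˡ []       _              = []
  Unique-++⁻ˡ (x ∷ xs) (x∉xs ∷ uniq) = Allₚ.++⁻ˡ xs x∉xs ∷ Unique-++⁻ˡ xs uniq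

  Unique-++⁻ʳ : ∀ xs {ys : List A} → Unique (xs ++ ys) → Unique ys
  Unique-++⁻ʳ []       uniq       = uniq
  Unique-++⁻ʳ (x ∷ xs) (_ ∷ uniq) = Unique-++⁻ʳ xs uniq

  Unique-++⇒Disjoint : ∀ xs {ys : List A} → Unique (xs ++ ys) → Disjoint xs ys
  Unique-++⇒Disjoint (x ∷ xs) (x∉ ∷ _) (here refl , v∈ys) = All¬⇒¬Any (Allₚ.++⁻ʳ xs x∉) v∈ys
  Unique-++⇒Disjoint (x ∷ xs) (_ ∷ uniq) (there v∈xs , v∈ys) = Unique-++⇒Disjoint xs uniq (v∈xs , v∈ys)

  Unique⇒lookup-injective : ∀ {l : List A} → Unique l → ∀ i j → List.lookup l i ≡ List.lookup l j → i ≡ j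
  Unique⇒lookup-injective {x ∷ l} _          fzero    fzero    _  = refl
  Unique⇒lookup-injective {x ∷ l} uniq       fzero    (fsuc j) eq =
    contradiction (subst (_∈ l) (sym eq) (∈-lookup j)) (Unique[x∷xs]⇒x∉xs uniq)
  Unique⇒lookup-injective {x ∷ l} uniq       (fsuc i) fzero    eq =
    contradiction (subst (_∈ l) eq (∈-lookup i)) (Unique[x∷xs]⇒x∉xs uniq)
  Unique⇒lookup-injective {x ∷ l} (_ ∷ uniq) (fsuc i) (fsuc j) eq = cong fsuc (Unique⇒lookup-injective uniq i j eq)

  Rotation : List A → List A → Set
  Rotation l l′ = ∃₂ λ xs ys → l ≡ xs ++ ys × l′ ≡ ys ++ xs

  rotation-to : ∀ {x : A} {l} → x ∈ l → ∃[ r ] Rotation l (x ∷ r)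
  rotation-to x∈l with ∈-∃++ x∈l
  ... | xs , ys , refl = ys ++ xs , xs , _ ∷ ys , refl , refl

  Rotation-sym : ∀ {l l′ : List A} → Rotation l l′ → Rotation l′ l
  Rotation-sym (xs , ys , eq , eq′) = ys , xs , eq′ , eq

  Rotation-∈ : ∀ {l l′} {v : A} → Rotation l l′ → v ∈ l → v ∈ l′
  Rotation-∈ (xs , ys , refl , refl) = ∈-resp-↭ (++-comm xs ys)

  Rotation-Unique : ∀ {l l′ : List A} → Rotation l l′ → Unique l → Unique l′
  Rotation-Unique (xs , ys , refl , refl) uniq =
    ++⁺ (Unique-++⁻ʳ xs uniq) (Unique-++⁻ˡ xs uniq) λ { (v∈ys , v∈xs) → Unique-++⇒Disjoint xs uniq (v∈xs , v∈ys) }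

  Rotation-length : ∀ {l l′ : List A} → Rotation l l′ → length l ≡ length l′
  Rotation-length (xs , ys , refl , refl) = trans (length-++ xs) (trans (+-comm (length xs) (length ys)) (sym (length-++ ys)))

module _ {A : Set} where

  at : List A → ℕ → Maybe A
  at []       _       = nothing
  at (x ∷ xs) zero    = just x
  at (x ∷ xs) (suc k) = at xs k

  at⇒∈ : ∀ l {x : A} k → at l k ≡ just x → x ∈ l
  at⇒∈ (y ∷ l) zero    refl = here refl
  at⇒∈ (y ∷ l) (suc k) eq   = there (at⇒∈ l k eq)

  ∈⇒at : ∀ {x : A} {l} → x ∈ l → ∃[ k ] at l k ≡ just x
  ∈⇒at (here refl) = zero , refl
  ∈⇒at (there x∈l) = let k , eq = ∈⇒at x∈l in suc k , eq

  at⇒< : ∀ l {x : A} k → at l k ≡ just x → k < length l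
  at⇒< (y ∷ l) zero    _  = s≤s z≤n
  at⇒< (y ∷ l) (suc k) eq = s≤s (at⇒< l k eq)

  <⇒at : ∀ l k → k < length l → ∃[ x ] at l k ≡ just x
  <⇒at (y ∷ l) zero    _         = y , refl
  <⇒at (y ∷ l) (suc k) (s≤s k<l) = <⇒at l k k<l

  at-++⁺ˡ : ∀ l {r : List A} k → k < length l → at (l ++ r) k ≡ at l k
  at-++⁺ˡ (y ∷ l) zero    _         = refl
  at-++⁺ˡ (y ∷ l) (suc k) (s≤s k<l) = at-++⁺ˡ l k k<l

  at-length-++ : ∀ l {v : A} {r} → at (l ++ v ∷ r) (length l) ≡ just v
  at-length-++ []      = refl
  at-length-++ (y ∷ l) = at-length-++ l

  at-snoc : ∀ l {v : A} {y} k → at (l ++ [ v ]) k ≡ just y →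
            (k < length l × at l k ≡ just y) ⊎ (k ≡ length l × y ≡ v)
  at-snoc []      zero    refl = inj₂ (refl , refl)
  at-snoc (a ∷ l) zero    eq   = inj₁ (s≤s z≤n , eq)
  at-snoc (a ∷ l) (suc k) eq with at-snoc l k eq
  ... | inj₁ (k<l , eq′) = inj₁ (s≤s k<l , eq′)
  ... | inj₂ (refl , eq′) = inj₂ (refl , eq′)

  at-injective : ∀ {l} → Unique l → ∀ {x : A} i j → at l i ≡ just x → at l j ≡ just x → i ≡ j
  at-injective {y ∷ l} _          zero    zero    _    _    = refl
  at-injective {y ∷ l} uniq       zero    (suc j) refl eq   = contradiction (at⇒∈ l j eq) (Unique[x∷xs]⇒x∉xs uniq)
  at-injective {y ∷ l} uniq       (suc i) zero    eq   refl = contradiction (at⇒∈ l i eq) (Unique[x∷xs]⇒x∉xs uniq)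
  at-injective {y ∷ l} (_ ∷ uniq) (suc i) (suc j) eq   eq′  = cong suc (at-injective uniq i j eq eq′)

module _ {n : ℕ} where
  private
    V = Fin n

  Step-++⁺ˡ : ∀ {x y : V} {xs} ys → Step x y xs → Step x y (xs ++ ys)
  Step-++⁺ˡ ys here      = here
  Step-++⁺ˡ ys (there s) = there (Step-++⁺ˡ ys s)

  Step-++⁺ʳ : ∀ {x y : V} xs {ys} → Step x y ys → Step x y (xs ++ ys)
  Step-++⁺ʳ []       s = s
  Step-++⁺ʳ (a ∷ xs) s = there (Step-++⁺ʳ xs s)

  Step⇒∈ˡ : ∀ {x y : V} {l} → Step x y l → x ∈ l
  Step⇒∈ˡ here      = here refl
  Step⇒∈ˡ (there s) = there (Step⇒∈ˡ s)

  Step⇒∈ʳ : ∀ {x y : V} {l} → Step x y l → y ∈ l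
  Step⇒∈ʳ here      = there (here refl)
  Step⇒∈ʳ (there s) = there (Step⇒∈ʳ s)

  Step-snoc⇒∈ : ∀ {x y z : V} l → Step x y (l ++ [ z ]) → x ∈ l
  Step-snoc⇒∈ (a ∷ [])    here      = here refl
  Step-snoc⇒∈ (a ∷ b ∷ l) here      = here refl
  Step-snoc⇒∈ (a ∷ b ∷ l) (there s) = there (Step-snoc⇒∈ (b ∷ l) s)
  Step-snoc⇒∈ [] (there ())
  Step-snoc⇒∈ (a ∷ []) (there (there ()))

  Step-++-∷⁻ : ∀ {x y : V} xs z zs → Step x y (xs ++ z ∷ zs) → Step x y (xs ++ [ z ]) ⊎ Step x y (z ∷ zs)
  Step-++-∷⁻ []          z zs s         = inj₂ s
  Step-++-∷⁻ (a ∷ [])    z zs here      = inj₁ here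
  Step-++-∷⁻ (a ∷ [])    z zs (there s) = inj₂ s
  Step-++-∷⁻ (a ∷ b ∷ xs) z zs here     = inj₁ here
  Step-++-∷⁻ (a ∷ b ∷ xs) z zs (there s) with Step-++-∷⁻ (b ∷ xs) z zs s
  ... | inj₁ s′ = inj₁ (there s′)
  ... | inj₂ s′ = inj₂ s′

  Step-++-∷⁺ : ∀ {x y : V} xs z zs → Step x y (xs ++ [ z ]) ⊎ Step x y (z ∷ zs) → Step x y (xs ++ z ∷ zs)
  Step-++-∷⁺ (a ∷ [])     z zs (inj₁ here)      = here
  Step-++-∷⁺ (a ∷ b ∷ xs) z zs (inj₁ here)      = here
  Step-++-∷⁺ (a ∷ b ∷ xs) z zs (inj₁ (there s)) = there (Step-++-∷⁺ (b ∷ xs) z zs (inj₁ s))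
  Step-++-∷⁺ xs           z zs (inj₂ s)         = Step-++⁺ʳ xs s
  Step-++-∷⁺ [] z zs (inj₁ (there ()))
  Step-++-∷⁺ (a ∷ []) z zs (inj₁ (there (there ())))

  Step? : (x y : V) → ∀ l → Dec (Step x y l)
  Step? x y []          = no λ ()
  Step? x y (a ∷ [])    = no λ { (there ()) }
  Step? x y (a ∷ b ∷ l) with x ≟ a | y ≟ b | Step? x y (b ∷ l)
  ... | yes refl | yes refl | _      = yes here
  ... | _        | _        | yes s  = yes (there s)
  ... | no x≢a   | _        | no ¬s  = no λ { here → x≢a refl ; (there s) → ¬s s }
  ... | yes _    | no y≢b   | no ¬s  = no λ { here → y≢b refl ; (there s) → ¬s s }

  Step⇒at : ∀ {x y : V} {l} → Step x y l → ∃[ k ] at l k ≡ just x × at l (suc k) ≡ just y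
  Step⇒at here      = zero , refl , refl
  Step⇒at (there s) = let k , eq , eq′ = Step⇒at s in suc k , eq , eq′

  at⇒Step : ∀ {x y : V} l k → at l k ≡ just x → at l (suc k) ≡ just y → Step x y l
  at⇒Step (a ∷ b ∷ l) zero    refl refl = here
  at⇒Step (a ∷ l)     (suc k) eq   eq′  = there (at⇒Step l k eq eq′)
  at⇒Step (a ∷ [])    zero    _    ()

Next : ℕ → ℕ → ℕ → Set
Next m k k′ = k′ ≡ suc k ⊎ (suc k ≡ m × k′ ≡ 0)

module _ {n : ℕ} where
  private
    V = Fin n

  close : List V → List V
  close l = l ++ take 1 l

  close-∈ : ∀ {x : V} l → x ∈ close l → x ∈ l
  close-∈ []      x∈l = x∈l
  close-∈ (a ∷ l) x∈l with ∈-++⁻ (a ∷ l) x∈l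
  ... | inj₁ x∈al       = x∈al
  ... | inj₂ (here refl) = here refl

  private
    close-split : ∀ {x y : V} a xs b ys → Step x y (close (a ∷ xs ++ b ∷ ys)) →
                  Step x y (a ∷ xs ++ [ b ]) ⊎ Step x y (b ∷ ys ++ [ a ])
    close-split {x} {y} a xs b ys s =
      Step-++-∷⁻ (a ∷ xs) b (ys ++ [ a ]) (subst (Step x y) (++-assoc (a ∷ xs) (b ∷ ys) [ a ]) s)

    close-join : ∀ {x y : V} a xs b ys → Step x y (a ∷ xs ++ [ b ]) ⊎ Step x y (b ∷ ys ++ [ a ]) →
                 Step x y (close (a ∷ xs ++ b ∷ ys))
    close-join {x} {y} a xs b ys s =
      subst (Step x y) (sym (++-assoc (a ∷ xs) (b ∷ ys) [ a ])) (Step-++-∷⁺ (a ∷ xs) b (ys ++ [ a ]) s)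

    close-++-comm : ∀ {x y : V} xs ys → Step x y (close (xs ++ ys)) → Step x y (close (ys ++ xs))
    close-++-comm []       ys s rewrite ++-identityʳ ys = s
    close-++-comm {x} {y} (a ∷ xs) [] s = subst (λ l → Step x y (close (a ∷ l))) (++-identityʳ xs) s
    close-++-comm (a ∷ xs) (b ∷ ys) s = close-join b ys a xs (⊎-swap (close-split a xs b ys s))

  Rotation-close : ∀ {x y : V} {l l′} → Rotation l l′ → Step x y (close l) → Step x y (close l′)
  Rotation-close (xs , ys , refl , refl) = close-++-comm xs ys

  close-Step⇒Next : ∀ l {x y : V} → Step x y (close l) →
                    ∃₂ λ k k′ → at l k ≡ just x × at l k′ ≡ just y × Next (length l) k k′
  close-Step⇒Next (a ∷ l) s with Step⇒at s
  ... | k , eq , eq′ with at-snoc (a ∷ l) k eq | at-snoc (a ∷ l) (suc k) eq′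
  ... | inj₁ (_ , at-x) | inj₁ (_ , at-y)    = k , suc k , at-x , at-y , inj₁ refl
  ... | inj₁ (_ , at-x) | inj₂ (k+1≡m , refl) = k , zero , at-x , refl , inj₂ (k+1≡m , refl)
  ... | inj₂ (refl , _) | inj₁ (k+1<m , _)    = contradiction (<-trans (n<1+n (length (a ∷ l))) k+1<m) (<-irrefl refl)
  ... | inj₂ (refl , _) | inj₂ (k+1≡m , _)    = contradiction (n<1+n _) (<-irrefl (sym k+1≡m))
  close-Step⇒Next [] ()

  Next⇒close-Step : ∀ l {x y : V} k k′ → at l k ≡ just x → at l k′ ≡ just y → Next (length l) k k′ →
                    Step x y (close l)
  Next⇒close-Step (a ∷ l) {x} {y} k k′ at-x at-y next =
    at⇒Step ((a ∷ l) ++ [ a ]) k (trans (at-++⁺ˡ (a ∷ l) k (at⇒< (a ∷ l) k at-x)) at-x) (at-y′ next)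
    where
    at-y′ : Next (length (a ∷ l)) k k′ → at ((a ∷ l) ++ [ a ]) (suc k) ≡ just y
    at-y′ (inj₁ refl)            = trans (at-++⁺ˡ (a ∷ l) (suc k) (at⇒< (a ∷ l) k′ at-y)) at-y
    at-y′ (inj₂ (k+1≡m , refl)) =
      trans (subst (λ i → at ((a ∷ l) ++ [ a ]) i ≡ just a) (sym k+1≡m) (at-length-++ (a ∷ l))) at-y

  close-Step-asym : ∀ {l} → Unique l → 3 ≤ length l → ∀ {x y : V} → Step x y (close l) → ¬ Step y x (close l)
  close-Step-asym {l} uniq 3≤m s s′ with close-Step⇒Next l s | close-Step⇒Next l s′
  ... | k , k′ , at-x , at-y , next | j′ , j , at-y′ , at-x′ , next′
    with at-injective uniq k′ j′ at-y at-y′ | at-injective uniq k j at-x at-x′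
  ... | refl | refl = impossible next next′
    where
    impossible : ∀ {k k′} → Next (length l) k k′ → ¬ Next (length l) k′ k
    impossible (inj₁ refl) (inj₁ eq)              = <-irrefl eq (<-trans (n<1+n _) (n<1+n _))
    impossible (inj₁ refl) (inj₂ (2≡m , refl))    = <-irrefl 2≡m 3≤m
    impossible (inj₂ (1≡m , refl)) (inj₁ refl)    = <-irrefl 1≡m 3≤m
    impossible (inj₂ (_ , refl)) (inj₂ (1≡m , _)) = <-irrefl 1≡m (≤-trans (s≤s (s≤s z≤n)) 3≤m)

  close-Step-exists : ∀ l → 3 ≤ length l → ∃₂ λ (x y : V) → Step x y (close l)
  close-Step-exists (x ∷ y ∷ _) _ = x , y , here
  close-Step-exists (_ ∷ []) (s≤s ())

-- Walks

IsWalk : {n : ℕ} → Graph n → List (Fin n) → Set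
IsWalk G l = ∀ x y → Step x y l → adj G x y ≡ true

Reach-⊆ : {n : ℕ} {G G′ : Graph n} {P : Fin n → Set} {u v : Fin n} →
          (∀ x y → adj G x y ≡ true → adj G′ x y ≡ true) → Reach G P u v → Reach G′ P u v
Reach-⊆ G⊆G′ here           = here
Reach-⊆ G⊆G′ (step e pw r) = step (G⊆G′ _ _ e) pw (Reach-⊆ G⊆G′ r)

module _ {n : ℕ} {G : Graph n} where
  private
    V = Fin n

  Reach-map : {P Q : V → Set} {u v : V} → (∀ x → P x → Q x) → Reach G P u v → Reach G Q u v
  Reach-map f here          = here
  Reach-map f (step e pw r) = step e (f _ pw) (Reach-map f r)

  Reach-++ : {P : V → Set} {u v w : V} → Reach G P u v → Reach G P v w → Reach G P u w
  Reach-++ here          r′ = r′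
  Reach-++ (step e pw r) r′ = step e pw (Reach-++ r r′)

  Reach-reverse : {P : V → Set} {u v : V} → P u → Reach G P u v → Reach G P v u
  Reach-reverse pu here          = here
  Reach-reverse pu (step e pw r) = Reach-++ (Reach-reverse pw r) (step (trans (Graph.sym G _ _) e) pu here)

  Reach-first-step : {P : V → Set} {u v : V} → Reach G P u v → u ≢ v → ∃[ w ] adj G u w ≡ true × P w
  Reach-first-step here          u≢v = contradiction refl u≢v
  Reach-first-step (step e pw r) _   = _ , e , pw

  IsWalk⇒Reach : ∀ l {u v : V} → IsWalk G (u ∷ l ++ [ v ]) → Reach G (λ _ → ⊤) u v
  IsWalk⇒Reach []      walk = step (walk _ _ here) tt here
  IsWalk⇒Reach (w ∷ l) walk = step (walk _ _ here) tt (IsWalk⇒Reach l (λ x y s → walk x y (there s)))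

  first-exit : {P Q : V → Set} → Decidable Q → {u v : V} → Reach G P u v → Q u → ¬ Q v →
               ∃₂ λ x y → Q x × ¬ Q y × adj G x y ≡ true
  first-exit Q? here qu ¬qv = contradiction qu ¬qv
  first-exit Q? {u} (step {w = w} e _ r) qu ¬qv with Q? w
  ... | yes qw = first-exit Q? r qw ¬qv
  ... | no ¬qw = u , w , qu , ¬qw , e

  first-entry : {P Q : V → Set} → Decidable Q → {u v : V} → Reach G P u v → ¬ Q u → Q v →
                ∃₂ λ y x → Reach G (λ z → P z × ¬ Q z) u y × adj G y x ≡ true × P x × Q x
  first-entry Q? here ¬qu qv = contradiction qv ¬qu
  first-entry Q? {u} (step {w = w} e pw r) ¬qu qv with Q? w
  ... | yes qw = u , w , here , e , pw , qw
  ... | no ¬qw = let y , x , r′ , e′ , px , qx = first-entry Q? r ¬qw qv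
                 in y , x , step e (pw , ¬qw) r′ , e′ , px , qx

  Reach⇒path : {P : V → Set} {u v t : V} → Reach G P u v → P u → adj G v t ≡ true →
               ∃[ l ] Unique (u ∷ l) × IsWalk G (u ∷ l ++ [ t ]) × All P (u ∷ l)
  Reach⇒path {u = u} here pu e = [] , [] ∷ [] , walk , pu ∷ []
    where
    walk : IsWalk G (u ∷ [ _ ])
    walk x y here = e
    walk x y (there (there ()))
  Reach⇒path {u = u} {t = t} (step {w = w} e pw r) pu e′ with Reach⇒path r pw e′
  ... | l , uniq , walk , all with u ∈? (w ∷ l)
  ...   | no u∉ = w ∷ l , Unique-∷ u∉ uniq , walk′ , pu ∷ all
    where
    walk′ : IsWalk G (u ∷ w ∷ l ++ [ t ])
    walk′ x y here      = e
    walk′ x y (there s) = walk x y s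
  ...   | yes u∈ with ∈-∃++ u∈
  ...     | xs , ys , eq =
    ys , Unique-++⁻ʳ xs (subst Unique eq uniq) , walk′ , Allₚ.++⁻ʳ xs (subst (All _) eq all)
    where
    walk′ : IsWalk G (u ∷ ys ++ [ t ])
    walk′ x y s = walk x y (subst (Step x y) (cong (_++ [ t ]) (sym eq))
                              (subst (Step x y) (sym (++-assoc xs (u ∷ ys) [ t ])) (Step-++⁺ʳ xs s)))

  private
    Within : List V → V → Set
    Within A x = x ∈ A

    Into : List V → V → V → Set
    Into A a u = u ≡ a ⊎ ∃[ x ] Reach G (Within A) u x × adj G x a ≡ true

    Reach-∷⁻ : {a : V} {A : List V} {u v : V} → Reach G (Within (a ∷ A)) u v →
               Reach G (Within A) u v ⊎ (Into A a u × Reach G (Within A) a v)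
    Reach-∷⁻ here = inj₁ here
    Reach-∷⁻ {u = u} (step e pw r) with Reach-∷⁻ r | pw
    ... | inj₁ r′                        | here refl = inj₂ (inj₂ (u , here , e) , r′)
    ... | inj₁ r′                        | there pw′ = inj₁ (step e pw′ r′)
    ... | inj₂ (inj₁ refl , r′)          | _         = inj₂ (inj₂ (u , here , e) , r′)
    ... | inj₂ (inj₂ (x , rx , ex) , r′) | here refl = inj₂ (inj₂ (u , here , e) , r′)
    ... | inj₂ (inj₂ (x , rx , ex) , r′) | there pw′ = inj₂ (inj₂ (x , step e pw′ rx , ex) , r′)

    Reach-∷⁺ : {a : V} {A : List V} {u v : V} →
               Reach G (Within A) u v ⊎ (Into A a u × Reach G (Within A) a v) → Reach G (Within (a ∷ A)) u v
    Reach-∷⁺ (inj₁ r)                         = Reach-map (λ _ → there) r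
    Reach-∷⁺ (inj₂ (inj₁ refl , r))           = Reach-map (λ _ → there) r
    Reach-∷⁺ (inj₂ (inj₂ (x , rx , ex) , r)) =
      Reach-++ (Reach-map (λ _ → there) rx) (step ex (here refl) (Reach-map (λ _ → there) r))

    -- Induction on the list of admissible intermediate vertices, as in the Floyd–Warshall algorithm.
    reach-within? : ∀ A (u v : V) → Dec (Reach G (Within A) u v)
    reach-within? [] u v with u ≟ v
    ... | yes refl = yes here
    ... | no u≢v  = no λ { here → u≢v refl ; (step _ () _) }
    reach-within? (a ∷ A) u v = map′ Reach-∷⁺ Reach-∷⁻
      (reach-within? A u v ⊎-dec
        ((u ≟ a ⊎-dec any? (λ x → reach-within? A u x ×-dec (adj G x a Bool.≟ true))) ×-dec reach-within? A a v))

  reach? : {P : V → Set} → Decidable P → ∀ u v → Dec (Reach G P u v)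
  reach? P? u v = map′ (Reach-map λ x x∈ → proj₂ (∈-filter⁻ P? {xs = allFin n} x∈))
                       (Reach-map λ x px → ∈-filter⁺ P? (∈-allFin x) px)
                       (reach-within? (filter P? (allFin n)) u v)

Reach-reroute : {n : ℕ} {G G′ : Graph n} → (∀ x y → adj G x y ≡ true → Reach G′ (λ _ → ⊤) x y) →
                {u v : Fin n} → Reach G (λ _ → ⊤) u v → Reach G′ (λ _ → ⊤) u v
Reach-reroute detour here         = here
Reach-reroute detour (step e _ r) = Reach-++ (detour _ _ e) (Reach-reroute detour r)

module _ {A : Set} {P : A → Set} (P? : Decidable P) (f : A → ℕ) (xs : List A) where

  maximum-by : ∀ {x₀} → P x₀ → ∃[ y ] P y × (∀ z → z ∈ xs → P z → f z ≤ f y)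
  maximum-by {x₀} px₀ =
    argmax f x₀ (filter P? xs) , argmax-all f px₀ (all-filter P? xs) ,
    λ z z∈xs pz → All.lookup (f[xs]≤f[argmax] x₀ (filter P? xs)) (∈-filter⁺ P? z∈xs pz)

  minimum-by : ∀ {x₀} → P x₀ → ∃[ y ] P y × (∀ z → z ∈ xs → P z → f y ≤ f z)
  minimum-by {x₀} px₀ =
    argmin f x₀ (filter P? xs) , argmin-all f px₀ (all-filter P? xs) ,
    λ z z∈xs pz → All.lookup (f[argmin]≤f[xs] x₀ (filter P? xs)) (∈-filter⁺ P? z∈xs pz)

module _ {A : Set} (xs : List A) where

  lists : ℕ → List (List A)
  lists zero    = [ [] ]
  lists (suc k) = [] ∷ cartesianProductWith _∷_ xs (lists k)

  vecs : (k : ℕ) → List (Vec A k)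
  vecs zero    = [ []ᵥ ]
  vecs (suc k) = cartesianProductWith _∷ᵥ_ xs (vecs k)

module _ {A : Set} {xs : List A} (complete : ∀ x → x ∈ xs) where

  ∈-lists : ∀ k l → length l ≤ k → l ∈ lists xs k
  ∈-lists zero    []      _         = here refl
  ∈-lists (suc k) []      _         = here refl
  ∈-lists (suc k) (x ∷ l) (s≤s l≤k) = there (∈-cartesianProductWith⁺ _∷_ (complete x) (∈-lists k l l≤k))

  ∈-vecs : ∀ {k} (v : Vec A k) → v ∈ vecs xs k
  ∈-vecs []ᵥ       = here refl
  ∈-vecs (x ∷ᵥ v) = ∈-cartesianProductWith⁺ _∷ᵥ_ (complete x) (∈-vecs v)

module _ {n : ℕ} where
  private
    V = Fin n

  Unique⇒length≤ : {l : List V} → Unique l → length l ≤ n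
  Unique⇒length≤ {l} uniq with length l ≤? n
  ... | yes l≤n = l≤n
  ... | no  l≰n with pigeonhole (≰⇒> l≰n) (List.lookup l)
  ...   | i , j , i<j , eq = contradiction (cong toℕ (Unique⇒lookup-injective uniq i j eq)) (λ i≡j → <-irrefl i≡j i<j)

  uniqueLists : List (List V)
  uniqueLists = lists (allFin n) n

  Unique⇒∈-uniqueLists : {l : List V} → Unique l → l ∈ uniqueLists
  Unique⇒∈-uniqueLists uniq = ∈-lists ∈-allFin n _ (Unique⇒length≤ uniq)

-- Graphs up to equal adjacency, and their enumeration

module _ {n : ℕ} where
  private
    V = Fin n

  adj⇒≢ : (G : Graph n) {a b : V} → adj G a b ≡ true → a ≢ b
  adj⇒≢ G {a} e refl with () ← trans (sym e) (irrefl G a)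

  record _≈G_ (G G′ : Graph n) : Set where
    field
      adj-≡ : ∀ i j → adj G i j ≡ adj G′ i j
  open _≈G_

  ≈G-sym : {G G′ : Graph n} → G ≈G G′ → G′ ≈G G
  adj-≡ (≈G-sym eq) i j = sym (adj-≡ eq i j)

  ≈G⇒⊆G : {G G′ : Graph n} → G ≈G G′ → G ⊆G G′
  ≈G⇒⊆G eq i j e = trans (sym (adj-≡ eq i j)) e

  ⊆G-respˡ-≈G : {G G′ : Graph n} (H : Graph n) → G ≈G G′ → G ⊆G H → G′ ⊆G H
  ⊆G-respˡ-≈G H eq sub i j e = sub i j (≈G⇒⊆G (≈G-sym eq) i j e)

  Connected-≈G : {G G′ : Graph n} → G ≈G G′ → Connected G → Connected G′
  Connected-≈G eq conn u v = Reach-⊆ (≈G⇒⊆G eq) (conn u v)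

  Cycle-≈G : {G G′ : Graph n} → G ≈G G′ → Cycle G → Cycle G′
  Cycle-≈G eq c = record { verts = verts c ; len = len c ; uniq = uniq c ; closed = λ x y s → ≈G⇒⊆G eq x y (closed c x y s) }

  Cactus-≈G : {G G′ : Graph n} → G ≈G G′ → Cactus G → Cactus G′
  Cactus-≈G eq (conn , one) =
    Connected-≈G eq conn , λ c₁ c₂ → one (Cycle-≈G (≈G-sym eq) c₁) (Cycle-≈G (≈G-sym eq) c₂)

  edgeCount-≈G : {G G′ : Graph n} → G ≈G G′ → edgeCount G ≡ edgeCount G′
  edgeCount-≈G eq = cong sum (map-cong (λ i → cong sum (map-cong (λ j →
    cong (λ b → if (toℕ i <ᵇ toℕ j) ∧ b then 1 else 0) (adj-≡ eq i j)) (allFin n))) (allFin n))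

  missing-edge : (G H : Graph n) → G ⊆G H → ¬ G ≈G H → ∃₂ λ a b → adj H a b ≡ true × adj G a b ≡ false
  missing-edge G H sub G≉H with any? (λ a → any? λ b → (adj H a b Bool.≟ true) ×-dec (adj G a b Bool.≟ false))
  ... | yes missing = missing
  ... | no ¬missing = contradiction (record { adj-≡ = G≈H }) G≉H
    where
    G≈H : ∀ i j → adj G i j ≡ adj H i j
    G≈H i j with adj G i j in eG | adj H i j in eH
    ... | true  | true  = refl
    ... | false | false = refl
    ... | true  | false = trans (sym (sub i j eG)) eH
    ... | false | true  = contradiction (i , j , eH , eG) ¬missing

  -- Graphs are enumerated through adjacency matrices; fromMatrix imposes symmetry and
  -- irreflexivity, so that every graph is ≈G to the graph of its own matrix.
  fromMatrix : Vec (Vec Bool n) n → Graph n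
  fromMatrix M = record
    { adj    = matrixAdj
    ; sym    = λ i j → cong₂ _∧_ (∧-comm (matrixAdj′ i j) _) (cong not (does-⇔ (mk⇔ sym sym) (i ≟ j) (j ≟ i)))
    ; irrefl = λ i → trans (cong (λ b → (matrixAdj′ i i ∧ matrixAdj′ i i) ∧ not b) (dec-true (i ≟ i) refl)) (∧-zeroʳ _)
    }
    where
    matrixAdj′ : V → V → Bool
    matrixAdj′ i j = lookup (lookup M i) j
    matrixAdj : V → V → Bool
    matrixAdj i j = (matrixAdj′ i j ∧ matrixAdj′ j i) ∧ not (does (i ≟ j))

  toMatrix : Graph n → Vec (Vec Bool n) n
  toMatrix G = tabulate λ i → tabulate (adj G i)

  fromMatrix-toMatrix : (G : Graph n) → fromMatrix (toMatrix G) ≈G G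
  adj-≡ (fromMatrix-toMatrix G) i j
    rewrite lookup∘tabulate (λ i → tabulate (adj G i)) i | lookup∘tabulate (adj G i) j
          | lookup∘tabulate (λ i → tabulate (adj G i)) j | lookup∘tabulate (adj G j) i
    with i ≟ j
  ... | yes refl rewrite irrefl G i = refl
  ... | no _     rewrite Graph.sym G j i = trans (∧-identityʳ _) (∧-idem _)

  private
    bools : ∀ b → b ∈ true ∷ false ∷ []
    bools true  = here refl
    bools false = there (here refl)

    rows : List (Vec Bool n)
    rows = vecs (true ∷ false ∷ []) n

  graphs : List (Graph n)
  graphs = map fromMatrix (vecs rows n)

  ∈-graphs : ∀ M → fromMatrix M ∈ graphs
  ∈-graphs M = ∈-map⁺ fromMatrix (∈-vecs (∈-vecs bools) M)

  module _ {P : Graph n → Set} (P? : Decidable P) (P-≈G : ∀ {G G′} → G ≈G G′ → P G → P G′) where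
    private
      represent : ∀ {S′} → P S′ → fromMatrix (toMatrix S′) ∈ graphs × P (fromMatrix (toMatrix S′))
      represent {S′} pS′ = ∈-graphs (toMatrix S′) , P-≈G (≈G-sym (fromMatrix-toMatrix S′)) pS′

      edgeCount-represent : ∀ S′ → edgeCount (fromMatrix (toMatrix S′)) ≡ edgeCount S′
      edgeCount-represent S′ = edgeCount-≈G (fromMatrix-toMatrix S′)

    maximum-edgeCount : ∀ {G₀} → P G₀ → ∃[ S ] P S × (∀ S′ → P S′ → edgeCount S′ ≤ edgeCount S)
    maximum-edgeCount pG₀ with maximum-by P? edgeCount graphs pG₀
    ... | S , pS , max = S , pS , λ S′ pS′ →
      subst (_≤ edgeCount S) (edgeCount-represent S′) (max _ (proj₁ (represent pS′)) (proj₂ (represent pS′)))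

    minimum-edgeCount : ∀ {G₀} → P G₀ → ∃[ S ] P S × (∀ S′ → P S′ → edgeCount S ≤ edgeCount S′)
    minimum-edgeCount pG₀ with minimum-by P? edgeCount graphs pG₀
    ... | S , pS , min = S , pS , λ S′ pS′ →
      subst (edgeCount S ≤_) (edgeCount-represent S′) (min _ (proj₁ (represent pS′)) (proj₂ (represent pS′)))

module _ {n : ℕ} (G : Graph n) where
  private
    V = Fin n

  isWalk? : ∀ l → Dec (IsWalk G l)
  isWalk? l = all? λ x → all? λ y → Step? x y l →-dec (adj G x y Bool.≟ true)

  AtMostOneCycle : Set
  AtMostOneCycle = ∀ (c₁ c₂ : Cycle G) x y → CycEdge c₁ x y → CycEdge c₂ x y → SameCycle c₁ c₂

  private
    IsCycle : List V → Set
    IsCycle l = 3 ≤ length l × Unique l × IsWalk G (close l)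

    toCycle : ∀ {l} → IsCycle l → Cycle G
    toCycle {l} (3≤l , uniq , walk) = record { verts = l ; len = 3≤l ; uniq = uniq ; closed = walk }

    CycEdgeL : List V → V → V → Set
    CycEdgeL l x y = Step x y (close l) ⊎ Step y x (close l)

    SameCycleL : List V → List V → Set
    SameCycleL l₁ l₂ = ∀ a b → (CycEdgeL l₁ a b → CycEdgeL l₂ a b) × (CycEdgeL l₂ a b → CycEdgeL l₁ a b)

    AgreeOnSharedEdge : List V → List V → Set
    AgreeOnSharedEdge l₁ l₂ =
      IsCycle l₁ → IsCycle l₂ → ∀ x y → CycEdgeL l₁ x y → CycEdgeL l₂ x y → SameCycleL l₁ l₂

    AtMostOneCycleL : Set
    AtMostOneCycleL = All (λ l₁ → All (AgreeOnSharedEdge l₁) uniqueLists) uniqueLists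

    isCycle? : ∀ l → Dec (IsCycle l)
    isCycle? l = (3 ≤? length l) ×-dec unique? l ×-dec isWalk? (close l)

    cycEdgeL? : ∀ l x y → Dec (CycEdgeL l x y)
    cycEdgeL? l x y = Step? x y (close l) ⊎-dec Step? y x (close l)

    sameCycleL? : ∀ l₁ l₂ → Dec (SameCycleL l₁ l₂)
    sameCycleL? l₁ l₂ = all? λ a → all? λ b →
      (cycEdgeL? l₁ a b →-dec cycEdgeL? l₂ a b) ×-dec (cycEdgeL? l₂ a b →-dec cycEdgeL? l₁ a b)

    agreeOnSharedEdge? : ∀ l₁ l₂ → Dec (AgreeOnSharedEdge l₁ l₂)
    agreeOnSharedEdge? l₁ l₂ = isCycle? l₁ →-dec (isCycle? l₂ →-dec all? λ x → all? λ y →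
      cycEdgeL? l₁ x y →-dec (cycEdgeL? l₂ x y →-dec sameCycleL? l₁ l₂))

    AtMostOneCycleL⇒AtMostOneCycle : AtMostOneCycleL → AtMostOneCycle
    AtMostOneCycleL⇒AtMostOneCycle one c₁ c₂ =
      All.lookup (All.lookup one (Unique⇒∈-uniqueLists (uniq c₁))) (Unique⇒∈-uniqueLists (uniq c₂))
        (len c₁ , uniq c₁ , closed c₁) (len c₂ , uniq c₂ , closed c₂)

    AtMostOneCycle⇒AtMostOneCycleL : AtMostOneCycle → AtMostOneCycleL
    AtMostOneCycle⇒AtMostOneCycleL one =
      All.tabulate λ _ → All.tabulate λ _ cyc₁ cyc₂ → one (toCycle cyc₁) (toCycle cyc₂)

  atMostOneCycle? : Dec AtMostOneCycle
  atMostOneCycle? = map′ AtMostOneCycleL⇒AtMostOneCycle AtMostOneCycle⇒AtMostOneCycleL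
    (All.all? (λ l₁ → All.all? (agreeOnSharedEdge? l₁) uniqueLists) uniqueLists)

  connected? : Dec (Connected G)
  connected? = all? λ u → all? λ v → reach? (λ _ → yes tt) u v

  cactus? : Dec (Cactus G)
  cactus? = connected? ×-dec atMostOneCycle?

  cutVertex? : Dec (∃[ v ] CutVertex G v)
  cutVertex? = any? λ v → any? λ u → any? λ w →
    ¬? (u ≟ v) ×-dec ¬? (w ≟ v) ×-dec ¬? (reach? (λ x → ¬? (x ≟ v)) u w)

  _⊆G?_ : (H : Graph n) → Dec (G ⊆G H)
  _⊆G?_ H = all? λ i → all? λ j → (adj G i j Bool.≟ true) →-dec (adj H i j Bool.≟ true)

-- Changing one edge

module _ {A : Set} (f g : A → ℕ) where

  sum-map-cong : ∀ xs → (∀ x → x ∈ xs → f x ≡ g x) → sum (map f xs) ≡ sum (map g xs)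
  sum-map-cong []       _    = refl
  sum-map-cong (x ∷ xs) f≡g = cong₂ _+_ (f≡g x (here refl)) (sum-map-cong xs λ y y∈ → f≡g y (there y∈))

  sum-map-suc : ∀ {x₀} xs → Unique xs → x₀ ∈ xs → (∀ x → x ≢ x₀ → f x ≡ g x) → f x₀ ≡ suc (g x₀) →
                sum (map f xs) ≡ suc (sum (map g xs))
  sum-map-suc (x ∷ xs) uniq (here refl) f≡g fx₀ =
    cong₂ _+_ fx₀ (sum-map-cong xs λ y y∈ → f≡g y λ { refl → Unique[x∷xs]⇒x∉xs uniq y∈ })
  sum-map-suc (x ∷ xs) uniq@(_ ∷ uniq₀) (there x₀∈) f≡g fx₀ =
    trans (cong₂ _+_ (f≡g x λ { refl → Unique[x∷xs]⇒x∉xs uniq x₀∈ }) (sum-map-suc xs uniq₀ x₀∈ f≡g fx₀))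
          (+-suc (g x) _)

module _ {n : ℕ} where
  private
    V = Fin n

  Pair : V → V → V → V → Set
  Pair a b x y = (x ≡ a × y ≡ b) ⊎ (x ≡ b × y ≡ a)

  pair? : ∀ a b x y → Dec (Pair a b x y)
  pair? a b x y = ((x ≟ a) ×-dec (y ≟ b)) ⊎-dec ((x ≟ b) ×-dec (y ≟ a))

  Pair-comm : ∀ {a b x y} → Pair a b x y → Pair a b y x
  Pair-comm (inj₁ (p , q)) = inj₂ (q , p)
  Pair-comm (inj₂ (p , q)) = inj₁ (q , p)

  Pair-swap : ∀ {a b x y} → Pair a b x y → Pair b a x y
  Pair-swap = ⊎-swap

  private
    isPair : V → V → V → V → Bool
    isPair a b x y = does (pair? a b x y)

    isPair-comm : ∀ a b x y → isPair a b x y ≡ isPair a b y x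
    isPair-comm a b x y = does-⇔ (mk⇔ Pair-comm Pair-comm) (pair? a b x y) (pair? a b y x)

    isPair-diag : ∀ {a b} x → a ≢ b → isPair a b x x ≡ false
    isPair-diag x a≢b = dec-false (pair? _ _ x x) λ { (inj₁ (refl , refl)) → a≢b refl ; (inj₂ (refl , refl)) → a≢b refl }

  removeEdge : Graph n → V → V → Graph n
  removeEdge G a b = record
    { adj    = λ x y → adj G x y ∧ not (isPair a b x y)
    ; sym    = λ x y → cong₂ (λ p q → p ∧ not q) (Graph.sym G x y) (isPair-comm a b x y)
    ; irrefl = λ x → cong (_∧ _) (irrefl G x)
    }

  addEdge : Graph n → (a b : V) → a ≢ b → Graph n
  addEdge G a b a≢b = record
    { adj    = λ x y → adj G x y ∨ isPair a b x y
    ; sym    = λ x y → cong₂ _∨_ (Graph.sym G x y) (isPair-comm a b x y)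
    ; irrefl = λ x → cong₂ _∨_ (irrefl G x) (isPair-diag x a≢b)
    }

  removeEdge-⊆G : (G : Graph n) (a b : V) → removeEdge G a b ⊆G G
  removeEdge-⊆G G a b x y e with adj G x y
  ... | true = refl

  adj-removeEdge-≢ : ∀ (G : Graph n) {a b x y} → ¬ Pair a b x y → adj (removeEdge G a b) x y ≡ adj G x y
  adj-removeEdge-≢ G {x = x} {y} ¬pair =
    trans (cong (λ q → adj G x y ∧ not q) (dec-false (pair? _ _ _ _) ¬pair)) (∧-identityʳ _)

  adj-removeEdge-false : ∀ (G : Graph n) {a b x y} → adj G x y ≡ false → adj (removeEdge G a b) x y ≡ false
  adj-removeEdge-false G e rewrite e = refl

  adj-removeEdge-≡ : ∀ (G : Graph n) {a b x y} → Pair a b x y → adj (removeEdge G a b) x y ≡ false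
  adj-removeEdge-≡ G {x = x} {y} pair =
    trans (cong (λ q → adj G x y ∧ not q) (dec-true (pair? _ _ _ _) pair)) (∧-zeroʳ _)

  adj-addEdge-≢ : ∀ (G : Graph n) {a b x y} (a≢b : a ≢ b) → ¬ Pair a b x y → adj (addEdge G a b a≢b) x y ≡ adj G x y
  adj-addEdge-≢ G {x = x} {y} _ ¬pair = trans (cong (adj G x y ∨_) (dec-false (pair? _ _ _ _) ¬pair)) (∨-identityʳ _)

  adj-addEdge-≡ : ∀ (G : Graph n) {a b x y} (a≢b : a ≢ b) → Pair a b x y → adj (addEdge G a b a≢b) x y ≡ true
  adj-addEdge-≡ G {x = x} {y} _ pair = trans (cong (adj G x y ∨_) (dec-true (pair? _ _ _ _) pair)) (∨-zeroʳ _)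

  ⊆G-addEdge : (G : Graph n) {a b : V} (a≢b : a ≢ b) → G ⊆G addEdge G a b a≢b
  ⊆G-addEdge G _ x y e rewrite e = refl

  adj-addEdge⁻ : ∀ (G : Graph n) {a b x y} (a≢b : a ≢ b) → adj (addEdge G a b a≢b) x y ≡ true →
                 adj G x y ≡ true ⊎ Pair a b x y
  adj-addEdge⁻ G {a} {b} {x} {y} a≢b e with pair? a b x y
  ... | yes pair = inj₂ pair
  ... | no ¬pair = inj₁ (trans (sym (adj-addEdge-≢ G a≢b ¬pair)) e)

  private
    count : Graph n → V → V → ℕ
    count G i j = if (toℕ i <ᵇ toℕ j) ∧ adj G i j then 1 else 0

    row : Graph n → V → ℕ
    row G i = sum (map (count G i) (allFin n))

    edgeCount-suc-< : (G₁ G₂ : Graph n) {a b : V} → toℕ a < toℕ b → adj G₁ a b ≡ false → adj G₂ a b ≡ true →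
                      (∀ x y → ¬ Pair a b x y → adj G₁ x y ≡ adj G₂ x y) → edgeCount G₂ ≡ suc (edgeCount G₁)
    edgeCount-suc-< G₁ G₂ {a} {b} a<b e₁ e₂ agree =
      sum-map-suc (row G₂) (row G₁) (allFin n) (allFin⁺ n) (∈-allFin a) other-row row-a
      where
      count-agree : ∀ i j → ¬ (i ≡ a × j ≡ b) → count G₂ i j ≡ count G₁ i j
      count-agree i j ¬ab with pair? a b i j
      ... | no ¬pair              = cong (λ t → if (toℕ i <ᵇ toℕ j) ∧ t then 1 else 0) (sym (agree i j ¬pair))
      ... | yes (inj₁ ab)         = contradiction ab ¬ab
      ... | yes (inj₂ (refl , refl)) rewrite dec-false (toℕ b <? toℕ a) (<-asym a<b) = refl

      count-ab : count G₂ a b ≡ suc (count G₁ a b)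
      count-ab rewrite dec-true (toℕ a <? toℕ b) a<b | e₁ | e₂ = refl

      row-a : row G₂ a ≡ suc (row G₁ a)
      row-a = sum-map-suc (count G₂ a) (count G₁ a) (allFin n) (allFin⁺ n) (∈-allFin b)
                (λ j j≢b → count-agree a j (j≢b ∘ proj₂)) count-ab

      other-row : ∀ i → i ≢ a → row G₂ i ≡ row G₁ i
      other-row i i≢a = sum-map-cong (count G₂ i) (count G₁ i) (allFin n) λ j _ → count-agree i j (i≢a ∘ proj₁)

  edgeCount-suc : (G₁ G₂ : Graph n) {a b : V} → a ≢ b → adj G₁ a b ≡ false → adj G₂ a b ≡ true →
                  (∀ x y → ¬ Pair a b x y → adj G₁ x y ≡ adj G₂ x y) → edgeCount G₂ ≡ suc (edgeCount G₁)
  edgeCount-suc G₁ G₂ {a} {b} a≢b e₁ e₂ agree with <-cmp (toℕ a) (toℕ b)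
  ... | tri< a<b _ _ = edgeCount-suc-< G₁ G₂ a<b e₁ e₂ agree
  ... | tri≈ _ a≡b _ = contradiction (toℕ-injective a≡b) a≢b
  ... | tri> _ _ b<a = edgeCount-suc-< G₁ G₂ b<a (trans (Graph.sym G₁ b a) e₁) (trans (Graph.sym G₂ b a) e₂)
                         λ x y ¬pair → agree x y (¬pair ∘ Pair-swap)

  edgeCount-removeEdge : (G : Graph n) {a b : V} → adj G a b ≡ true → edgeCount G ≡ suc (edgeCount (removeEdge G a b))
  edgeCount-removeEdge G e = edgeCount-suc (removeEdge G _ _) G (adj⇒≢ G e) (adj-removeEdge-≡ G (inj₁ (refl , refl))) e
    λ x y ¬pair → adj-removeEdge-≢ G ¬pair

  edgeCount-addEdge : (G : Graph n) {a b : V} (a≢b : a ≢ b) → adj G a b ≡ false →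
                      edgeCount (addEdge G a b a≢b) ≡ suc (edgeCount G)
  edgeCount-addEdge G a≢b e = edgeCount-suc G (addEdge G _ _ a≢b) a≢b e (adj-addEdge-≡ G a≢b (inj₁ (refl , refl)))
    λ x y ¬pair → sym (adj-addEdge-≢ G a≢b ¬pair)

-- Cycles and cuts

module _ {n : ℕ} (X : Fin n → Set) where

  Crosses : Fin n → Fin n → Set
  Crosses p q = (X p × ¬ X q) ⊎ (¬ X p × X q)

  Crosses-sym : ∀ {p q} → Crosses p q → Crosses q p
  Crosses-sym (inj₁ (xp , ¬xq)) = inj₂ (¬xq , xp)
  Crosses-sym (inj₂ (¬xp , xq)) = inj₁ (xq , ¬xp)

  Enters : List (Fin n) → Set
  Enters l = ∃₂ λ p q → Step p q l × ¬ X p × X q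

module _ {n : ℕ} {X : Fin n → Set} (X? : Decidable X) where

  enters : ∀ {u} l → ¬ X u → Any X l → Enters X (u ∷ l)
  enters {u} (w ∷ l) ¬xu any with X? w
  ... | yes xw = u , w , here , ¬xu , xw
  enters (w ∷ l) ¬xu (here xw)  | no ¬xw = contradiction xw ¬xw
  enters (w ∷ l) ¬xu (there any) | no ¬xw = let p , q , s , ¬xp , xq = enters l ¬xw any in p , q , there s , ¬xp , xq

  -- Rotate the cycle to start outside X; the closed walk then has to enter X before returning.
  close-enters : ∀ {l x y} → x ∈ l → X x → y ∈ l → ¬ X y → Enters X (close l)
  close-enters {x = x} x∈l xx y∈l ¬xy with rotation-to y∈l
  ... | r , rot with Rotation-∈ rot x∈l
  ...   | here refl = contradiction xx ¬xy
  ...   | there x∈r =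
    let p , q , s , ¬xp , xq = enters (r ++ [ _ ]) ¬xy (lose (∈-++⁺ˡ x∈r) xx)
    in p , q , Rotation-close (Rotation-sym rot) s , ¬xp , xq

module _ {n : ℕ} {X : Fin n → Set} (X? : Decidable X) where

  close-leaves : ∀ {l x y} → x ∈ l → X x → y ∈ l → ¬ X y → ∃₂ λ p q → Step p q (close l) × X p × ¬ X q
  close-leaves x∈l xx y∈l ¬xy with close-enters {X = λ v → ¬ X v} (¬? ∘ X?) y∈l ¬xy x∈l (λ ¬xx → ¬xx xx)
  ... | p , q , s , ¬¬xp , ¬xq = p , q , s , decidable-stable (X? p) ¬¬xp , ¬xq

module _ {n : ℕ} {G : Graph n} (D : Cycle G) {X : Fin n → Set} (X? : Decidable X) where
  private
    V = Fin n
    StepD : V → V → Set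
    StepD p q = Step p q (close (verts D))

    asym : ∀ {x y} → StepD x y → ¬ StepD y x
    asym = close-Step-asym (uniq D) (len D)

    ∈D : ∀ {x y} → StepD x y → x ∈ verts D × y ∈ verts D
    ∈D s = close-∈ (verts D) (Step⇒∈ˡ s) , close-∈ (verts D) (Step⇒∈ʳ s)

  module _ {u₁ v₁ u₂ v₂ : V} (xu₁ : X u₁) (¬xv₁ : ¬ X v₁) (xu₂ : X u₂) (¬xv₂ : ¬ X v₂)
           (only : ∀ p q → StepD p q → Crosses X p q → Pair u₁ v₁ p q ⊎ Pair u₂ v₂ p q) where
    leave⇒enter : StepD u₁ v₁ → StepD v₂ u₂
    leave⇒enter s with close-enters X? (proj₁ (∈D s)) xu₁ (proj₂ (∈D s)) ¬xv₁
    ... | p , q , s′ , ¬xp , xq with only p q s′ (inj₂ (¬xp , xq))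
    ... | inj₁ (inj₁ (refl , _))    = contradiction xu₁ ¬xp
    ... | inj₁ (inj₂ (refl , refl)) = contradiction s′ (asym s)
    ... | inj₂ (inj₁ (refl , _))    = contradiction xu₂ ¬xp
    ... | inj₂ (inj₂ (refl , refl)) = s′

    enter⇒leave : StepD v₁ u₁ → StepD u₂ v₂
    enter⇒leave s with close-leaves X? (proj₂ (∈D s)) xu₁ (proj₁ (∈D s)) ¬xv₁
    ... | p , q , s′ , xp , ¬xq with only p q s′ (inj₁ (xp , ¬xq))
    ... | inj₁ (inj₁ (refl , refl)) = contradiction s′ (asym s)
    ... | inj₁ (inj₂ (refl , _))    = contradiction xp ¬xv₁
    ... | inj₂ (inj₁ (refl , refl)) = s′
    ... | inj₂ (inj₂ (refl , _))    = contradiction xp ¬xv₂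

    -- A cycle crosses a cut an even number of times.
    CycEdge-cut-pair : CycEdge D u₁ v₁ → CycEdge D u₂ v₂
    CycEdge-cut-pair (inj₁ s) = inj₂ (leave⇒enter s)
    CycEdge-cut-pair (inj₂ s) = inj₁ (enter⇒leave s)

  CycEdge-cut-bridge : ∀ {u v} → X u → ¬ X v → (∀ p q → StepD p q → Crosses X p q → Pair u v p q) → ¬ CycEdge D u v
  CycEdge-cut-bridge xu ¬xv only (inj₁ s) = asym s (leave⇒enter xu ¬xv xu ¬xv (λ p q s c → inj₁ (only p q s c)) s)
  CycEdge-cut-bridge xu ¬xv only (inj₂ s) = asym s (enter⇒leave xu ¬xv xu ¬xv (λ p q s c → inj₁ (only p q s c)) s)

module _ {n : ℕ} {G : Graph n} where

  other-vertex : (c : Cycle G) → ∀ x → ∃[ y ] y ∈ verts c × y ≢ x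
  other-vertex c x with verts c | uniq c | len c
  ... | _ ∷ [] | _ | s≤s ()
  ... | c₀ ∷ c₁ ∷ _ | (c₀∉ ∷ _) | _ with c₀ ≟ x
  ...   | yes refl = c₁ , there (here refl) , λ c₁≡c₀ → All.head c₀∉ (sym c₁≡c₀)
  ...   | no c₀≢x = c₀ , here refl , c₀≢x

-- Spanning cacti

module _ {n : ℕ} where

  Connected-removeEdge-cycle : (T : Graph n) → Connected T → (c : Cycle T) →
                               ∀ {v₀ v₁ rest} → verts c ≡ v₀ ∷ v₁ ∷ rest → Connected (removeEdge T v₀ v₁)
  Connected-removeEdge-cycle T conn c {v₀} {v₁} {rest} refl u v = Reach-reroute detour (conn u v)
    where
    T′ = removeEdge T v₀ v₁

    around : IsWalk T′ (v₁ ∷ rest ++ [ v₀ ])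
    around x y s with pair? v₀ v₁ x y
    ... | no ¬pair              = trans (adj-removeEdge-≢ T ¬pair) (closed c x y (there s))
    ... | yes (inj₁ (refl , refl)) = contradiction (Step-snoc⇒∈ (v₁ ∷ rest) s) (Unique[x∷xs]⇒x∉xs (uniq c))
    ... | yes (inj₂ (refl , refl)) = contradiction (there s) (close-Step-asym (uniq c) (len c) here)

    detour : ∀ x y → adj T x y ≡ true → Reach T′ (λ _ → ⊤) x y
    detour x y e with pair? v₀ v₁ x y
    ... | no ¬pair                 = step (trans (adj-removeEdge-≢ T ¬pair) e) tt here
    ... | yes (inj₁ (refl , refl)) = Reach-reverse tt (IsWalk⇒Reach rest around)
    ... | yes (inj₂ (refl , refl)) = IsWalk⇒Reach rest around

  -- A connected spanning subgraph with fewest edges is acyclic, hence vacuously a cactus.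
  spanning-cactus : (H : Graph n) → Connected H → ∃[ T ] T ⊆G H × Cactus T
  spanning-cactus H connH with minimum-edgeCount (λ G → (G ⊆G? H) ×-dec connected? G)
                                 (λ eq (sub , conn) → ⊆G-respˡ-≈G H eq sub , Connected-≈G eq conn) {H} ((λ _ _ e → e) , connH)
  ... | T , (T⊆H , connT) , minimal = T , T⊆H , connT , λ c → contradiction c acyclic
    where
    acyclic : ¬ Cycle T
    acyclic c with verts c in eq | len c
    ... | v₀ ∷ []        | s≤s ()
    ... | v₀ ∷ v₁ ∷ rest | _ =
      <-irrefl refl (subst (_≤ edgeCount T′) (edgeCount-removeEdge T e) (minimal T′ (T′⊆H , connT′)))
      where
      T′ = removeEdge T v₀ v₁
      e : adj T v₀ v₁ ≡ true
      e = closed c v₀ v₁ (subst (λ l → Step v₀ v₁ (close l)) (sym eq) here)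
      T′⊆H : T′ ⊆G H
      T′⊆H i j = T⊆H i j ∘ removeEdge-⊆G T v₀ v₁ i j
      connT′ : Connected T′
      connT′ = Connected-removeEdge-cycle T connT c eq

-- Cacti without cut vertices

module _ {n : ℕ} (S : Graph n) where
  private
    V = Fin n

  module _ (one : AtMostOneCycle S) (c : Cycle S) where
    private
      StepC : V → V → Set
      StepC p q = Step p q (close (verts c))

      common-first-step : ∀ r {a x : V} t → ∃[ h ] Step a h (a ∷ r ++ x ∷ t) × Step a h (a ∷ r ++ [ x ])
      common-first-step []      t = _ , here , here
      common-first-step (h ∷ r) t = h , here , here

      suc-length≤length-++ : ∀ (xs : List V) {y ys} → suc (length ys) ≤ length (xs ++ y ∷ ys)
      suc-length≤length-++ xs {y} {ys} = subst (suc (length ys) ≤_) (sym (length-++ xs)) (m≤n+m _ (length xs))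

    private
      -- An ear x ys x′ of c together with the arc of c from x′ to x forms a cycle D sharing an edge
      -- with c, so D and c have the same edges.
      module Ear {x x′ r₁ r₂} (rot : Rotation (verts c) (x′ ∷ r₁ ++ x ∷ r₂))
                 (ys : List V) (outside : All (_∉ verts c) ys) (ys-unique : Unique ys)
                 (ear : IsWalk S (x ∷ ys ++ [ x′ ])) where
        D : List V
        D = x′ ∷ r₁ ++ x ∷ ys

        arc : ∀ {p q} → Step p q (x′ ∷ r₁ ++ [ x ]) → StepC p q
        arc {p} {q} s = Rotation-close (Rotation-sym rot)
          (Step-++⁺ˡ [ x′ ] (subst (Step p q) (++-assoc (x′ ∷ r₁) [ x ] r₂) (Step-++⁺ˡ r₂ s)))

        close-D : close D ≡ (x′ ∷ r₁) ++ x ∷ (ys ++ [ x′ ])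
        close-D = cong (x′ ∷_) (++-assoc r₁ (x ∷ ys) [ x′ ])

        ear-step : ∀ {p q} → Step p q (x ∷ ys ++ [ x′ ]) → Step p q (close D)
        ear-step {p} {q} s = subst (Step p q) (sym close-D) (Step-++⁺ʳ (x′ ∷ r₁) s)

        D-unique : Unique D
        D-unique = subst Unique (cong (x′ ∷_) (++-assoc r₁ [ x ] ys)) (++⁺ arc-unique ys-unique disjoint)
          where
          arc-unique : Unique (x′ ∷ r₁ ++ [ x ])
          arc-unique = Unique-++⁻ˡ (x′ ∷ r₁ ++ [ x ])
            (subst Unique (cong (x′ ∷_) (sym (++-assoc r₁ [ x ] r₂))) (Rotation-Unique rot (uniq c)))
          disjoint : Disjoint (x′ ∷ r₁ ++ [ x ]) ys
          disjoint (here refl , v∈ys) = All.lookup outside v∈ys (Rotation-∈ (Rotation-sym rot) (here refl))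
          disjoint (there v∈ , v∈ys)  = All.lookup outside v∈ys
            (Rotation-∈ (Rotation-sym rot) (there (subst (_ ∈_) (++-assoc r₁ [ x ] r₂) (∈-++⁺ˡ v∈))))

        D-walk : IsWalk S (close D)
        D-walk p q s with Step-++-∷⁻ (x′ ∷ r₁) x (ys ++ [ x′ ]) (subst (Step p q) close-D s)
        ... | inj₁ s′ = closed c p q (arc s′)
        ... | inj₂ s′ = ear p q s′

        D-cycle : 3 ≤ length D → Cycle S
        D-cycle 3≤D = record { verts = D ; len = 3≤D ; uniq = D-unique ; closed = D-walk }

        same : (3≤D : 3 ≤ length D) → SameCycle (D-cycle 3≤D) c
        same 3≤D with common-first-step r₁ ys
        ... | h , s , s′ = one (D-cycle 3≤D) c x′ h (inj₁ (Step-++⁺ˡ _ s)) (inj₁ (arc s′))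

    ear-is-cycle-edge : ∀ {x x′} → x ∈ verts c → x′ ∈ verts c → x ≢ x′ → (ys : List V) → All (_∉ verts c) ys →
                        Unique ys → IsWalk S (x ∷ ys ++ [ x′ ]) → ys ≡ [] × CycEdge c x x′
    ear-is-cycle-edge {x} {x′} x∈c x′∈c x≢x′ ys outside ys-unique ear with rotation-to x′∈c
    ... | R , rot with Rotation-∈ rot x∈c
    ...   | here x≡x′ = contradiction x≡x′ x≢x′
    ...   | there x∈R with ∈-∃++ x∈R
    ...     | r₁ , r₂ , refl = cases r₁ ys rot outside ys-unique ear
      where
      cases : ∀ r₁ ys → Rotation (verts c) (x′ ∷ r₁ ++ x ∷ r₂) → All (_∉ verts c) ys → Unique ys →
              IsWalk S (x ∷ ys ++ [ x′ ]) → ys ≡ [] × CycEdge c x x′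
      cases r₁ (y ∷ ys) rot outside ys-unique ear =
        contradiction (y∈c (proj₁ (same 3≤D x y) (inj₁ (ear-step here)))) (All.lookup outside (here refl))
        where
        open Ear {r₁ = r₁} rot (y ∷ ys) outside ys-unique ear
        3≤D : 3 ≤ length D
        3≤D = s≤s (≤-trans (s≤s (s≤s z≤n)) (suc-length≤length-++ r₁))
        y∈c : CycEdge c x y → y ∈ verts c
        y∈c (inj₁ s) = close-∈ (verts c) (Step⇒∈ʳ s)
        y∈c (inj₂ s) = close-∈ (verts c) (Step⇒∈ˡ s)
      cases []       [] rot _ _ _ = refl , inj₂ (Rotation-close (Rotation-sym rot) here)
      cases (h ∷ r₁) [] rot outside ys-unique ear =
        refl , proj₁ (same (s≤s (s≤s (suc-length≤length-++ r₁))) x x′) (inj₁ (ear-step here))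
        where open Ear {r₁ = h ∷ r₁} rot [] outside ys-unique ear

private
  compare-with : ∀ {n} (a b z : Fin n) → z ≡ a ⊎ z ≡ b ⊎ (z ≢ a × z ≢ b)
  compare-with a b z with z ≟ a | z ≟ b
  ... | yes z≡a | _       = inj₁ z≡a
  ... | no _    | yes z≡b = inj₂ (inj₁ z≡b)
  ... | no z≢a  | no z≢b  = inj₂ (inj₂ (z≢a , z≢b))

third-vertex : ∀ {n} → 3 ≤ n → (a b : Fin n) → ∃[ z ] z ≢ a × z ≢ b
third-vertex {suc (suc (suc _))} _ a b
  with compare-with a b fzero | compare-with a b (fsuc fzero) | compare-with a b (fsuc (fsuc fzero))
... | inj₂ (inj₂ fresh) | _                 | _                 = _ , fresh
... | _                 | inj₂ (inj₂ fresh) | _                 = _ , fresh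
... | _                 | _                 | inj₂ (inj₂ fresh) = _ , fresh
... | inj₁ refl         | inj₁ ()           | _
... | inj₂ (inj₁ refl)  | inj₂ (inj₁ ())    | _
... | inj₁ refl         | inj₂ (inj₁ refl)  | inj₁ ()
... | inj₁ refl         | inj₂ (inj₁ refl)  | inj₂ (inj₁ ())
... | inj₂ (inj₁ refl)  | inj₁ refl         | inj₁ ()
... | inj₂ (inj₁ refl)  | inj₁ refl         | inj₂ (inj₁ ())
third-vertex {suc zero}       (s≤s ())
third-vertex {suc (suc zero)} (s≤s (s≤s ()))

module _ {n : ℕ} (S : Graph n) (no-cut : ∀ v → ¬ CutVertex S v) where
  private
    V = Fin n

  reach-avoiding : ∀ {v u w : V} → u ≢ v → w ≢ v → Reach S (_≢ v) u w
  reach-avoiding {v} {u} {w} u≢v w≢v with reach? (λ x → ¬? (x ≟ v)) u w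
  ... | yes r = r
  ... | no ¬r = contradiction (u , w , u≢v , w≢v , ¬r) (no-cut v)

  module _ (cactus : Cactus S) where
    private
      conn = proj₁ cactus
      one  = proj₂ cactus

    -- A vertex outside a cycle would yield, via a first exit and a detour avoiding the exit vertex,
    -- an ear of the cycle that is not a cycle edge.
    cycle-spanning : (c : Cycle S) → ∀ v → v ∈ verts c
    cycle-spanning c v with v ∈? verts c
    ... | yes v∈c = v∈c
    ... | no v∉c with other-vertex c v
    ...   | c₀ , c₀∈c , _ with first-exit (_∈? verts c) (conn c₀ v) c₀∈c v∉c
    ...     | x , y , x∈c , y∉c , exy with other-vertex c x
    ...       | x₂ , x₂∈c , x₂≢x with first-entry (_∈? verts c) (reach-avoiding (∈∉⇒≢ x∈c y∉c) x₂≢x) y∉c x₂∈c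
    ...         | y′ , x′ , r , e , x′≢x , x′∈c with Reach⇒path r (∈∉⇒≢ x∈c y∉c , y∉c) e
    ...           | path , path-unique , path-walk , path-avoids =
      contradiction (proj₁ (ear-is-cycle-edge S one c x∈c x′∈c (x′≢x ∘ sym) (y ∷ path)
                               (All.map proj₂ path-avoids) path-unique ear)) λ ()
      where
      ear : IsWalk S (x ∷ (y ∷ path) ++ [ x′ ])
      ear _ _ here      = exy
      ear p q (there s) = path-walk p q s

    cycle-carries-edges : (c : Cycle S) → ∀ x y → adj S x y ≡ true → CycEdge c x y
    cycle-carries-edges c x y e =
      proj₂ (ear-is-cycle-edge S one c (cycle-spanning c x) (cycle-spanning c y) (adj⇒≢ S e) [] [] [] chord)
      where
      chord : IsWalk S (x ∷ [ y ])
      chord _ _ here = e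
      chord _ _ (there (there ()))

  private
    IsPath : List V → Set
    IsPath l = 2 ≤ length l × Unique l × IsWalk S l

    isPath? : Decidable IsPath
    isPath? l = (2 ≤? length l) ×-dec unique? l ×-dec isWalk? S l

    closing-cycle : ∀ {p₀ p₁ w} Q₁ Q₂ → Unique (p₀ ∷ p₁ ∷ Q₁ ++ w ∷ Q₂) →
                    IsWalk S (p₀ ∷ p₁ ∷ Q₁ ++ w ∷ Q₂) → adj S w p₀ ≡ true → Cycle S
    closing-cycle {p₀} {p₁} {w} Q₁ Q₂ P-unique P-walk e = record
      { verts  = p₀ ∷ p₁ ∷ Q₁ ++ [ w ]
      ; len    = s≤s (s≤s (subst (1 ≤_) (sym (length-++ Q₁)) (m≤n+m 1 (length Q₁))))
      ; uniq   = Unique-++⁻ˡ (p₀ ∷ p₁ ∷ Q₁ ++ [ w ]) (subst Unique (sym P≡) P-unique)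
      ; closed = walk
      }
      where
      P≡ : (p₀ ∷ p₁ ∷ Q₁ ++ [ w ]) ++ Q₂ ≡ p₀ ∷ p₁ ∷ Q₁ ++ w ∷ Q₂
      P≡ = ++-assoc (p₀ ∷ p₁ ∷ Q₁) [ w ] Q₂
      walk : IsWalk S (close (p₀ ∷ p₁ ∷ Q₁ ++ [ w ]))
      walk x y s
        with Step-++-∷⁻ (p₀ ∷ p₁ ∷ Q₁) w [ p₀ ] (subst (Step x y) (++-assoc (p₀ ∷ p₁ ∷ Q₁) [ w ] [ p₀ ]) s)
      ... | inj₁ s′ = P-walk x y (subst (Step x y) P≡ (Step-++⁺ˡ Q₂ s′))
      ... | inj₂ here = e
      ... | inj₂ (there (there ()))

    edge-path : ∀ {u w} → adj S u w ≡ true → IsPath (u ∷ [ w ])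
    edge-path e = s≤s (s≤s z≤n) , Unique-∷ (λ { (here refl) → adj⇒≢ S e refl }) ([] ∷ []) , walk
      where
      walk : IsWalk S (_ ∷ [ _ ])
      walk _ _ here = e
      walk _ _ (there (there ()))

    some-edge : 3 ≤ n → Connected S → ∃₂ λ u w → adj S u w ≡ true
    some-edge 3≤n conn =
      let v₀ = fromℕ< (≤-trans (s≤s z≤n) 3≤n)
          z , z≢v₀ , _ = third-vertex 3≤n v₀ v₀
          w , e , _ = Reach-first-step (conn v₀ z) (z≢v₀ ∘ sym)
      in v₀ , w , e

  another-neighbour : 3 ≤ n → ∀ {u v} → u ≢ v → ∃[ w ] adj S u w ≡ true × w ≢ v
  another-neighbour 3≤n {u} {v} u≢v =
    let z , z≢u , z≢v = third-vertex 3≤n u v in Reach-first-step (reach-avoiding u≢v z≢v) (z≢u ∘ sym)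

  private
    longest-path-neighbour : ∀ {p₀ p₁ Q} → IsPath (p₀ ∷ p₁ ∷ Q) →
                             (∀ l → l ∈ uniqueLists → IsPath l → length l ≤ length (p₀ ∷ p₁ ∷ Q)) →
                             ∀ {w} → adj S p₀ w ≡ true → w ≢ p₁ → w ∈ Q
    longest-path-neighbour {p₀} {p₁} {Q} (_ , P-unique , P-walk) longest {w} e w≢p₁ with w ∈? (p₀ ∷ p₁ ∷ Q)
    ... | yes (here w≡p₀)          = contradiction (sym w≡p₀) (adj⇒≢ S e)
    ... | yes (there (here w≡p₁))  = contradiction w≡p₁ w≢p₁
    ... | yes (there (there w∈Q)) = w∈Q
    ... | no w∉P = contradiction (longest (w ∷ p₀ ∷ p₁ ∷ Q) (Unique⇒∈-uniqueLists extended-unique) extended) (<-irrefl refl)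
      where
      extended-unique : Unique (w ∷ p₀ ∷ p₁ ∷ Q)
      extended-unique = Unique-∷ w∉P P-unique
      extended : IsPath (w ∷ p₀ ∷ p₁ ∷ Q)
      extended = s≤s (s≤s z≤n) , extended-unique , λ { x y here → trans (Graph.sym S w p₀) e ; x y (there s) → P-walk x y s }

  -- The end p₀ of a longest path has all its neighbours on the path, and it has a neighbour other
  -- than p₁ because p₁ is not a cut vertex; the edge to that neighbour closes a cycle.
  cycle-exists : 3 ≤ n → Connected S → Cycle S
  cycle-exists 3≤n conn with maximum-by isPath? length uniqueLists (edge-path (proj₂ (proj₂ (some-edge 3≤n conn))))
  ... | [] , (() , _) , _
  ... | _ ∷ [] , (s≤s () , _) , _
  ... | p₀ ∷ p₁ ∷ Q , path@(_ , P-unique@(p₀∉ ∷ _) , P-walk) , longest with another-neighbour 3≤n (All.head p₀∉)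
  ...   | w , e , w≢p₁ with ∈-∃++ (longest-path-neighbour path longest e w≢p₁)
  ...     | Q₁ , Q₂ , refl = closing-cycle Q₁ Q₂ P-unique P-walk (trans (Graph.sym S w p₀) e)

-- Lollipops

record Numbering (n m : ℕ) : Set where
  field
    pos           : Fin n → ℕ
    pos<          : ∀ x → pos x < m
    pos-injective : ∀ {x y} → pos x ≡ pos y → x ≡ y
    vertex        : ∀ k → k < m → Fin n
    pos-vertex    : ∀ k (k<m : k < m) → pos (vertex k k<m) ≡ k

module ListNumbering {n : ℕ} (l : List (Fin n)) (l-unique : Unique l) (l-complete : ∀ v → v ∈ l) where

  pos : Fin n → ℕ
  pos x = proj₁ (∈⇒at (l-complete x))

  at-pos : ∀ x → at l (pos x) ≡ just x
  at-pos x = proj₂ (∈⇒at (l-complete x))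

  pos-at : ∀ {x k} → at l k ≡ just x → pos x ≡ k
  pos-at {x} {k} eq = at-injective l-unique (pos x) k (at-pos x) eq

  numbering : Numbering n (length l)
  numbering = record
    { pos           = pos
    ; pos<          = λ x → at⇒< l (pos x) (at-pos x)
    ; pos-injective = λ {x} {y} eq → just-injective (trans (sym (at-pos x)) (trans (cong (at l) eq) (at-pos y)))
    ; vertex        = λ k k<m → proj₁ (<⇒at l k k<m)
    ; pos-vertex    = λ k k<m → pos-at (proj₂ (<⇒at l k k<m))
    }

  close-Step⇒pos-Next : ∀ {x y} → Step x y (close l) → Next (length l) (pos x) (pos y)
  close-Step⇒pos-Next s with close-Step⇒Next l s
  ... | k , k′ , at-x , at-y , next rewrite pos-at at-x | pos-at at-y = next

  pos-Next⇒close-Step : ∀ {x y} → Next (length l) (pos x) (pos y) → Step x y (close l)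
  pos-Next⇒close-Step {x} {y} = Next⇒close-Step l (pos x) (pos y) (at-pos x) (at-pos y)

module _ {lo hi k : ℕ} where

  leave-interval : lo ≤ k × k ≤ hi → ¬ (lo ≤ suc k × suc k ≤ hi) → k ≡ hi
  leave-interval (lo≤k , k≤hi) out = ≤-antisym k≤hi (≮⇒≥ λ k<hi → out (≤-trans lo≤k (n≤1+n k) , k<hi))

  enter-interval : ¬ (lo ≤ k × k ≤ hi) → lo ≤ suc k × suc k ≤ hi → suc k ≡ lo
  enter-interval out (lo≤k+1 , k+1≤hi) =
    ≤-antisym (≮⇒≥ λ lo<k+1 → out (≤-pred lo<k+1 , ≤-trans (n≤1+n k) k+1≤hi)) lo≤k+1

module Lollipop {n m : ℕ} (G : Graph n) (N : Numbering n m) (a b : Fin n) (a≢b : a ≢ b)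
                (pos-a : Numbering.pos N a ≡ 0) (β+1<m : suc (Numbering.pos N b) < m)
                (adj⇒link : ∀ x y → adj G x y ≡ true →
                            Numbering.pos N y ≡ suc (Numbering.pos N x) ⊎ Numbering.pos N x ≡ suc (Numbering.pos N y)
                            ⊎ Pair a b x y)
                (path⇒adj : ∀ x y → Numbering.pos N y ≡ suc (Numbering.pos N x) → adj G x y ≡ true) where
  open Numbering N

  private
    V = Fin n
    β = pos b

  walk-down : ∀ k x → pos x ≡ k → Reach G (λ _ → ⊤) x a
  walk-down zero    x pos-x = subst (λ t → Reach G (λ _ → ⊤) t a) (pos-injective (trans pos-a (sym pos-x))) here
  walk-down (suc k) x pos-x = step (trans (Graph.sym G x y) (path⇒adj y x (trans pos-x (cong suc (sym pos-y))))) tt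
                                   (walk-down k y pos-y)
    where
    k<m : k < m
    k<m = ≤-trans (n≤1+n (suc k)) (subst (_< m) pos-x (pos< x))
    y = vertex k k<m
    pos-y : pos y ≡ k
    pos-y = pos-vertex k k<m

  connected : Connected G
  connected u v = Reach-++ (walk-down (pos u) u refl) (Reach-reverse tt (walk-down (pos v) v refl))

  private
    beyond-b : ∀ {s t} → Reach G (_≢ b) s t → β < pos s → β < pos t
    beyond-b here           β<s = β<s
    beyond-b {s} (step {w = w} e w≢b r) β<s = beyond-b r (step-beyond (adj⇒link s w e))
      where
      step-beyond : pos w ≡ suc (pos s) ⊎ pos s ≡ suc (pos w) ⊎ Pair a b s w → β < pos w
      step-beyond (inj₁ eq)                      = subst (β <_) (sym eq) (≤-trans β<s (n≤1+n _))
      step-beyond (inj₂ (inj₁ eq))               = ≤∧≢⇒< (≤-pred (subst (β <_) eq β<s)) (w≢b ∘ pos-injective ∘ sym)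
      step-beyond (inj₂ (inj₂ (inj₁ (refl , _)))) = contradiction (subst (β <_) pos-a β<s) n≮0
      step-beyond (inj₂ (inj₂ (inj₂ (refl , _)))) = contradiction β<s (<-irrefl refl)

  cut-vertex : CutVertex G b
  cut-vertex = u , a , u≢b , a≢b , λ r → contradiction (subst (β <_) pos-a (beyond-b r (subst (β <_) (sym pos-u) ≤-refl))) n≮0
    where
    u = vertex (suc β) β+1<m
    pos-u : pos u ≡ suc β
    pos-u = pos-vertex (suc β) β+1<m
    u≢b : u ≢ b
    u≢b u≡b = <-irrefl (trans (cong pos (sym u≡b)) pos-u) (n<1+n β)

  private
    Between : ℕ → ℕ → V → Set
    Between lo hi t = lo ≤ pos t × pos t ≤ hi

    between? : ∀ lo hi → Decidable (Between lo hi)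
    between? lo hi t = (lo ≤? pos t) ×-dec (pos t ≤? hi)

    path-crossing : ∀ lo hi {x y} → pos y ≡ suc (pos x) → Crosses (Between lo hi) x y → pos x ≡ hi ⊎ pos y ≡ lo
    path-crossing lo hi y≡x+1 (inj₁ (in-x , out-y)) =
      inj₁ (leave-interval in-x (subst (λ k → ¬ (lo ≤ k × k ≤ hi)) y≡x+1 out-y))
    path-crossing lo hi y≡x+1 (inj₂ (out-x , in-y)) =
      inj₂ (trans y≡x+1 (enter-interval out-x (subst (λ k → lo ≤ k × k ≤ hi) y≡x+1 in-y)))

    consecutive-determined : ∀ {x y u v} → pos y ≡ suc (pos x) → pos x ≡ pos u → pos v ≡ suc (pos u) → x ≡ u × y ≡ v
    consecutive-determined y≡x+1 x≡u v≡u+1 =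
      pos-injective x≡u , pos-injective (trans y≡x+1 (trans (cong suc x≡u) (sym v≡u+1)))


  SmallCycleEdge : V → V → Set
  SmallCycleEdge x y = (pos y ≡ suc (pos x) × pos x < β) ⊎ (pos x ≡ suc (pos y) × pos y < β) ⊎ Pair a b x y

  private
    SmallCycleEdge-sym : ∀ {x y} → SmallCycleEdge x y → SmallCycleEdge y x
    SmallCycleEdge-sym (inj₁ e)               = inj₂ (inj₁ e)
    SmallCycleEdge-sym (inj₂ (inj₁ e))        = inj₁ e
    SmallCycleEdge-sym (inj₂ (inj₂ pair))     = inj₂ (inj₂ (Pair-comm pair))

  module _ (D : Cycle G) where
    private
      StepD : V → V → Set
      StepD p q = Step p q (close (verts D))

      link : ∀ {p q} → StepD p q → pos q ≡ suc (pos p) ⊎ pos p ≡ suc (pos q) ⊎ Pair a b p q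
      link s = adj⇒link _ _ (closed D _ _ s)

      CycEdge-sym : ∀ {x y} → CycEdge D x y → CycEdge D y x
      CycEdge-sym = ⊎-swap

    -- Only {u, v} leaves the positions 0 … pos u, because the chord stays inside.
    path-edge-beyond-b : ∀ {u v} → β ≤ pos u → pos v ≡ suc (pos u) → ¬ CycEdge D u v
    path-edge-beyond-b {u} {v} β≤u v≡u+1 =
      CycEdge-cut-bridge D (between? 0 (pos u)) (z≤n , ≤-refl) (λ (_ , v≤u) → <-irrefl refl (subst (_≤ pos u) v≡u+1 v≤u))
        only
      where
      only : ∀ p q → StepD p q → Crosses (Between 0 (pos u)) p q → Pair u v p q
      only p q s cross with link s
      ... | inj₁ q≡p+1 with path-crossing 0 (pos u) q≡p+1 cross
      ...   | inj₁ p≡u = inj₁ (consecutive-determined q≡p+1 p≡u v≡u+1)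
      ...   | inj₂ q≡0 = contradiction (trans (sym q≡p+1) q≡0) λ ()
      only p q s cross | inj₂ (inj₁ p≡q+1) with path-crossing 0 (pos u) p≡q+1 (Crosses-sym (Between 0 (pos u)) cross)
      ...   | inj₁ q≡u = inj₂ (×-swap (consecutive-determined p≡q+1 q≡u v≡u+1))
      ...   | inj₂ p≡0 = contradiction (trans (sym p≡q+1) p≡0) λ ()
      only p q s cross | inj₂ (inj₂ pair) = contradiction cross (chord-inside pair)
        where
        a∈ : Between 0 (pos u) a
        a∈ = z≤n , subst (_≤ pos u) (sym pos-a) z≤n
        b∈ : Between 0 (pos u) b
        b∈ = z≤n , β≤u
        chord-inside : ∀ {p q} → Pair a b p q → ¬ Crosses (Between 0 (pos u)) p q
        chord-inside (inj₁ (refl , refl)) (inj₁ (_ , ¬xq)) = ¬xq b∈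
        chord-inside (inj₁ (refl , refl)) (inj₂ (¬xp , _)) = ¬xp a∈
        chord-inside (inj₂ (refl , refl)) (inj₁ (_ , ¬xq)) = ¬xq a∈
        chord-inside (inj₂ (refl , refl)) (inj₂ (¬xp , _)) = ¬xp b∈

    private
      -- Only {u, v} and the chord leave the positions pos v … β; the edge behind b is a bridge.
      module Rung {u v} (u<β : pos u < β) (v≡u+1 : pos v ≡ suc (pos u)) where
        X : V → Set
        X = Between (suc (pos u)) β

        b∈X : X b
        b∈X = u<β , ≤-refl
        a∉X : ¬ X a
        a∉X (u<a , _) = contradiction (subst (suc (pos u) ≤_) pos-a u<a) λ ()
        v∈X : X v
        v∈X = ≤-reflexive (sym v≡u+1) , subst (_≤ β) (sym v≡u+1) u<β
        u∉X : ¬ X u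
        u∉X (u<u , _) = <-irrefl refl u<u

        only : ∀ p q → StepD p q → Crosses X p q → Pair b a p q ⊎ Pair v u p q
        only p q s cross with link s
        ... | inj₁ q≡p+1 with path-crossing (suc (pos u)) β q≡p+1 cross
        ...   | inj₁ p≡β   = contradiction (inj₁ s) (path-edge-beyond-b (≤-reflexive (sym p≡β)) q≡p+1)
        ...   | inj₂ q≡u+1 = inj₂ (inj₂ (consecutive-determined q≡p+1 (suc-injective (trans (sym q≡p+1) q≡u+1)) v≡u+1))
        only p q s cross | inj₂ (inj₁ p≡q+1) with path-crossing (suc (pos u)) β p≡q+1 (Crosses-sym X cross)
        ...   | inj₁ q≡β   = contradiction (inj₂ s) (path-edge-beyond-b (≤-reflexive (sym q≡β)) p≡q+1)
        ...   | inj₂ p≡u+1 = let q≡u , p≡v = consecutive-determined p≡q+1 (suc-injective (trans (sym p≡q+1) p≡u+1)) v≡u+1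
                             in inj₂ (inj₁ (p≡v , q≡u))
        only p q s cross | inj₂ (inj₂ pair) = inj₁ (Pair-swap pair)

        chord⇒rung : CycEdge D b a → CycEdge D v u
        chord⇒rung = CycEdge-cut-pair D (between? (suc (pos u)) β) b∈X a∉X v∈X u∉X only

        rung⇒chord : CycEdge D v u → CycEdge D b a
        rung⇒chord = CycEdge-cut-pair D (between? (suc (pos u)) β) v∈X u∉X b∈X a∉X λ p q s cross → ⊎-swap (only p q s cross)

    chord-on-cycle : CycEdge D a b
    chord-on-cycle with close-Step-exists (verts D) (len D)
    ... | p , q , s with link s
    ...   | inj₁ q≡p+1 with pos p <? β
    ...     | yes p<β = CycEdge-sym (Rung.rung⇒chord p<β q≡p+1 (inj₂ s))
    ...     | no p≮β  = contradiction (inj₁ s) (path-edge-beyond-b (≮⇒≥ p≮β) q≡p+1)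
    chord-on-cycle | p , q , s | inj₂ (inj₁ p≡q+1) with pos q <? β
    ...     | yes q<β = CycEdge-sym (Rung.rung⇒chord q<β p≡q+1 (inj₁ s))
    ...     | no q≮β  = contradiction (inj₂ s) (path-edge-beyond-b (≮⇒≥ q≮β) p≡q+1)
    chord-on-cycle | p , q , s | inj₂ (inj₂ (inj₁ (refl , refl))) = inj₁ s
    chord-on-cycle | p , q , s | inj₂ (inj₂ (inj₂ (refl , refl))) = inj₂ s

    CycEdge⇒SmallCycleEdge : ∀ {x y} → CycEdge D x y → SmallCycleEdge x y
    CycEdge⇒SmallCycleEdge (inj₂ s) = SmallCycleEdge-sym (CycEdge⇒SmallCycleEdge (inj₁ s))
    CycEdge⇒SmallCycleEdge {x} {y} (inj₁ s) with link s
    ... | inj₁ y≡x+1 with pos x <? β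
    ...   | yes x<β = inj₁ (y≡x+1 , x<β)
    ...   | no x≮β  = contradiction (inj₁ s) (path-edge-beyond-b (≮⇒≥ x≮β) y≡x+1)
    CycEdge⇒SmallCycleEdge {x} {y} (inj₁ s) | inj₂ (inj₁ x≡y+1) with pos y <? β
    ...   | yes y<β = inj₂ (inj₁ (x≡y+1 , y<β))
    ...   | no y≮β  = contradiction (inj₂ s) (path-edge-beyond-b (≮⇒≥ y≮β) x≡y+1)
    CycEdge⇒SmallCycleEdge (inj₁ s) | inj₂ (inj₂ pair) = inj₂ (inj₂ pair)

    SmallCycleEdge⇒CycEdge : ∀ {x y} → SmallCycleEdge x y → CycEdge D x y
    SmallCycleEdge⇒CycEdge (inj₁ (y≡x+1 , x<β)) = CycEdge-sym (Rung.chord⇒rung x<β y≡x+1 (CycEdge-sym chord-on-cycle))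
    SmallCycleEdge⇒CycEdge (inj₂ (inj₁ (x≡y+1 , y<β))) = Rung.chord⇒rung y<β x≡y+1 (CycEdge-sym chord-on-cycle)
    SmallCycleEdge⇒CycEdge (inj₂ (inj₂ (inj₁ (refl , refl)))) = chord-on-cycle
    SmallCycleEdge⇒CycEdge (inj₂ (inj₂ (inj₂ (refl , refl)))) = CycEdge-sym chord-on-cycle

  cactus : Cactus G
  cactus = connected , λ c₁ c₂ _ _ _ _ x y →
    SmallCycleEdge⇒CycEdge c₂ ∘ CycEdge⇒SmallCycleEdge c₁ , SmallCycleEdge⇒CycEdge c₁ ∘ CycEdge⇒SmallCycleEdge c₂

-- The exchange

-- z is the predecessor of a on the Hamiltonian cycle a … b … z; S′ is the cycle a … b together with
-- the path b … z hanging at b.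
module Swap {n : ℕ} (H S : Graph n) (S⊆H : S ⊆G H) (c : Cycle S) (spanning : ∀ v → v ∈ verts c)
            (carries : ∀ x y → adj S x y ≡ true → CycEdge c x y)
            {a b : Fin n} (ab∈H : adj H a b ≡ true) (ab∉S : adj S a b ≡ false) where
  private
    V = Fin n
    r : List V
    r = proj₁ (rotation-to (spanning a))
    rot : Rotation (verts c) (a ∷ r)
    rot = proj₂ (rotation-to (spanning a))
    p : List V
    p = a ∷ r
    m : ℕ
    m = length p

    open ListNumbering p (Rotation-Unique rot (uniq c)) (λ v → Rotation-∈ rot (spanning v))
    open Numbering numbering using (pos-injective; pos<; vertex; pos-vertex)

    z : V
    z = vertex (length r) ≤-refl

    pos-z : pos z ≡ length r
    pos-z = pos-vertex (length r) ≤-refl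

    pos-a : pos a ≡ 0
    pos-a = pos-at refl

    last⇒z : ∀ {x} → suc (pos x) ≡ m → x ≡ z
    last⇒z x+1≡m = pos-injective (trans (suc-injective x+1≡m) (sym pos-z))

    first⇒a : ∀ {x} → pos x ≡ 0 → x ≡ a
    first⇒a x≡0 = pos-injective (trans x≡0 (sym pos-a))

    a≢b : a ≢ b
    a≢b = adj⇒≢ H ab∈H

    cycle-adj : ∀ {x y} → Next m (pos x) (pos y) → adj S x y ≡ true
    cycle-adj next = closed c _ _ (Rotation-close (Rotation-sym rot) (pos-Next⇒close-Step next))

    adj⇒Next : ∀ {x y} → adj S x y ≡ true → Next m (pos x) (pos y) ⊎ Next m (pos y) (pos x)
    adj⇒Next {x} {y} e with carries x y e
    ... | inj₁ s = inj₁ (close-Step⇒pos-Next (Rotation-close rot s))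
    ... | inj₂ s = inj₂ (close-Step⇒pos-Next (Rotation-close rot s))

    za∈S : adj S z a ≡ true
    za∈S = cycle-adj (inj₂ (cong suc pos-z , pos-a))

    S₁ : Graph n
    S₁ = removeEdge S z a

  S′ : Graph n
  S′ = addEdge S₁ a b a≢b

  S′⊆H : S′ ⊆G H
  S′⊆H x y e with adj-addEdge⁻ S₁ a≢b e
  ... | inj₁ e₁                    = S⊆H x y (removeEdge-⊆G S z a x y e₁)
  ... | inj₂ (inj₁ (refl , refl)) = ab∈H
  ... | inj₂ (inj₂ (refl , refl)) = trans (Graph.sym H b a) ab∈H

  edgeCount-S′ : edgeCount S′ ≡ edgeCount S
  edgeCount-S′ = trans (edgeCount-addEdge S₁ a≢b (adj-removeEdge-false S ab∉S))
                       (sym (edgeCount-removeEdge S za∈S))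

  private
    S′-link : ∀ x y → adj S′ x y ≡ true → pos y ≡ suc (pos x) ⊎ pos x ≡ suc (pos y) ⊎ Pair a b x y
    S′-link x y e with adj-addEdge⁻ S₁ a≢b e
    ... | inj₂ pair = inj₂ (inj₂ pair)
    ... | inj₁ e₁ with pair? z a x y
    ...   | yes za = contradiction (trans (sym e₁) (adj-removeEdge-≡ S za)) λ ()
    ...   | no ¬za with adj⇒Next (trans (sym (adj-removeEdge-≢ S ¬za)) e₁)
    ...     | inj₁ (inj₁ y≡x+1)          = inj₁ y≡x+1
    ...     | inj₁ (inj₂ (x+1≡m , y≡0)) = contradiction (inj₁ (last⇒z x+1≡m , first⇒a y≡0)) ¬za
    ...     | inj₂ (inj₁ x≡y+1)          = inj₂ (inj₁ x≡y+1)
    ...     | inj₂ (inj₂ (y+1≡m , x≡0)) = contradiction (inj₂ (first⇒a x≡0 , last⇒z y+1≡m)) ¬za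

    S′-path : ∀ x y → pos y ≡ suc (pos x) → adj S′ x y ≡ true
    S′-path x y y≡x+1 = ⊆G-addEdge S₁ a≢b x y (trans (adj-removeEdge-≢ S ¬za) (cycle-adj (inj₁ y≡x+1)))
      where
      ¬za : ¬ Pair z a x y
      ¬za (inj₁ (refl , refl)) = contradiction (trans (sym y≡x+1) pos-a) λ ()
      ¬za (inj₂ (refl , refl)) = contradiction (subst (λ k → 3 ≤ suc k) r≡1 3≤m) λ { (s≤s (s≤s ())) }
        where
        r≡1 : length r ≡ 1
        r≡1 = trans (sym pos-z) (trans y≡x+1 (cong suc pos-a))
        3≤m : 3 ≤ m
        3≤m = subst (3 ≤_) (Rotation-length rot) (len c)

    b+1<m : suc (pos b) < m
    b+1<m = ≤∧≢⇒< (pos< b) λ b+1≡m →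
      contradiction (trans (sym (trans (Graph.sym S a b) (cycle-adj (inj₂ (b+1≡m , pos-a))))) ab∉S) λ ()

  open Lollipop S′ numbering a b a≢b pos-a b+1<m S′-link S′-path public using (cactus; cut-vertex)

module _ {n : ℕ} (H : Graph n) where

  maximum-spanning-cactus : Connected H →
    ∃[ S ] (S ⊆G H × Cactus S) × (∀ S′ → S′ ⊆G H × Cactus S′ → edgeCount S′ ≤ edgeCount S)
  maximum-spanning-cactus connH =
    maximum-edgeCount (λ G → (G ⊆G? H) ×-dec cactus? G) (λ eq (sub , cac) → ⊆G-respˡ-≈G H eq sub , Cactus-≈G eq cac)
      (proj₂ (spanning-cactus H connH))

lemma3 : (n : ℕ) (H : Graph n) → 5 ≤ n → Connected H → ¬ Cactus H →
    ∃[ S ] (S ⊆G H × Cactus S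
    × (∀ (S′ : Graph n) → S′ ⊆G H → Cactus S′ → edgeCount S′ ≤ edgeCount S)
    × ∃[ v ] CutVertex S v)
lemma3 n H 5≤n connH ¬cactusH with maximum-spanning-cactus H connH
... | S , (S⊆H , cactusS) , maximal with cutVertex? S
...   | yes cut = S , S⊆H , cactusS , (λ S′ sub cac → maximal S′ (sub , cac)) , cut
...   | no ¬cut with missing-edge S H S⊆H (λ S≈H → ¬cactusH (Cactus-≈G S≈H cactusS))
...     | a , b , ab∈H , ab∉S =
  S′ , S′⊆H , cactus , (λ S″ sub cac → subst (edgeCount S″ ≤_) (sym edgeCount-S′) (maximal S″ (sub , cac))) ,
  b , cut-vertex
  where
  3≤n : 3 ≤ n
  3≤n = ≤-trans (s≤s (s≤s (s≤s z≤n))) 5≤n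
  no-cut : ∀ v → ¬ CutVertex S v
  no-cut v cut = ¬cut (v , cut)
  c : Cycle S
  c = cycle-exists S no-cut 3≤n (proj₁ cactusS)
  open Swap H S S⊆H c (cycle-spanning S no-cut cactusS c) (cycle-carries-edges S no-cut cactusS c) ab∈H ab∉S
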